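{- Let $P$ be a finite nonempty connected $\Gamma$-colored poset satisfying EC, NA, AC, and ICE2, let $m\ge1$, and let $p,q,r\ge0$ be integers with $r-p\ge0$. Then for distinct colors $b,c\in\Gamma$, $$\langle c^q,b^p,c^r\rangle=\sum_{k=0}^{\min\{p,q\}}\binom{q+r-p}{q-k}\langle b^{p-k},c^{q+r},b^k\rangle$$ as operators on $m$-tuples of ideals and on $m$-multisets of ideals.
   Context: $\kappa:P\to\Gamma$ is a surjective coloring by vertices of a finite simple graph; $a\sim b$ means adjacent. Axioms: (EC) equal-colored elements are comparable; (NA) elements in a covering relation have adjacent colors; (AC) elements with adjacent colors are comparable; (ICE2) if $x<y$ both have color $a$ and no element of color $a$ lies strictly between them, then $(x,y)$ contains exactly two elements whose colors are adjacent to $a$. For an order ideal $I$ and color $a$, $X_a.I=\sum I\cup\{x\}$ over minimal elements $x$ of $P-I$ of color $a$. On the complex vector space with basis the ordered $m$-tuples of order ideals, $X_a.(I_1,\dots,I_m)=\sum_j(I_1,\dots,X_a.I_j,\dots,I_m)$; likewise on the space with basis unordered $m$-multisets of ideals. $\langle a^k\rangle=\frac1{k!}X_a^k$ ($\langle a^0\rangle=\mathrm{id}$), and $\langle d_3^{n_3},d_2^{n_2},d_1^{n_1}\rangle=\langle d_3^{n_3}\rangle\circ\langle d_2^{n_2}\rangle\circ\langle d_1^{n_1}\rangle$. -}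

module Defs where

open import Data.Nat as ℕ using (ℕ; zero; suc; _∸_; _≡ᵇ_; _!)
open import Data.Nat.Properties using (_!≢0)
open import Data.Nat.Combinatorics using (_C_)
open import Data.Integer using (+_)
open import Data.Bool using (Bool; true; false; _∧_; not)
open import Data.Fin as Fin using (Fin)
open import Data.Fin.Subset using (Subset; _∈_; _∪_; ⁅_⁆)
open import Data.Vec as Vec using (Vec; _[_]≔_; lookup; toList)
import Data.Vec.Properties as VecP
import Data.Bool.Properties as BoolP
open import Data.List as List using (List; []; _∷_; concatMap; map; filterᵇ; length; foldr; _++_)
open import Data.Product using (_×_; _,_; ∃; Σ)
open import Data.Sum using (_⊎_)
open import Data.Rational as ℚ using (ℚ; 0ℚ)
open import Relation.Nullary using (¬_; ⌊_⌋)
open import Relation.Binary.PropositionalEquality using (_≡_; _≢_)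

allᵇ : {A : Set} → (A → Bool) → List A → Bool
allᵇ p = foldr (λ x b → p x ∧ b) true

record SimpleGraph (g : ℕ) : Set where
  field
    adj    : Fin g → Fin g → Bool
    irrefl : ∀ a → adj a a ≡ false
    sym    : ∀ a b → adj a b ≡ adj b a

_∼⟨_⟩_ : ∀ {g} → Fin g → SimpleGraph g → Fin g → Set
a ∼⟨ Γ ⟩ b = SimpleGraph.adj Γ a b ≡ true

record FinPoset (n : ℕ) : Set where
  field
    le      : Fin n → Fin n → Bool
    refl    : ∀ x → le x x ≡ true
    antisym : ∀ x y → le x y ≡ true → le y x ≡ true → x ≡ y
    trans   : ∀ x y z → le x y ≡ true → le y z ≡ true → le x z ≡ true

module _ {n : ℕ} (P : FinPoset n) where
  open FinPoset P

  ltᵇ : Fin n → Fin n → Bool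
  ltᵇ x y = le x y ∧ not ⌊ x Fin.≟ y ⌋

  _≤P_ : Fin n → Fin n → Set
  x ≤P y = le x y ≡ true

  _<P_ : Fin n → Fin n → Set
  x <P y = (x ≤P y) × (x ≢ y)

  Comparable : Fin n → Fin n → Set
  Comparable x y = (x ≤P y) ⊎ (y ≤P x)

  Covers : Fin n → Fin n → Set
  Covers x y = (x <P y) × ¬ (∃ λ z → (x <P z) × (z <P y))

  data Zigzag : Fin n → Fin n → Set where
    stop : ∀ {x} → Zigzag x x
    step : ∀ {x y z} → Comparable x z → Zigzag z y → Zigzag x y

  Connected : Set
  Connected = ∀ x y → Zigzag x y

  IsIdeal : Subset n → Set
  IsIdeal I = ∀ x y → y ≤P x → x ∈ I → y ∈ I

  countP : (Fin n → Bool) → ℕ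
  countP p = length (filterᵇ p (List.allFin n))

module _ {n g : ℕ} (Γ : SimpleGraph g) (P : FinPoset n) (κ : Fin n → Fin g) where
  open SimpleGraph Γ

  Surjective : Set
  Surjective = ∀ a → ∃ λ x → κ x ≡ a

  EC : Set
  EC = ∀ x y → κ x ≡ κ y → Comparable P x y

  NA : Set
  NA = ∀ x y → Covers P x y → κ x ∼⟨ Γ ⟩ κ y

  AC : Set
  AC = ∀ x y → κ x ∼⟨ Γ ⟩ κ y → Comparable P x y

  ICE2 : Set
  ICE2 = ∀ a x y → κ x ≡ a → κ y ≡ a → _<P_ P x y →
         (∀ z → _<P_ P x z → _<P_ P z y → κ z ≢ a) →
         countP P (λ z → ltᵇ P x z ∧ ltᵇ P z y ∧ adj (κ z) a) ≡ 2

  isMinOutᵇ : Subset n → Fin g → Fin n → Bool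
  isMinOutᵇ I a x =
    not (lookup I x) ∧ ⌊ κ x Fin.≟ a ⌋ ∧
    allᵇ (λ y → not (ltᵇ P y x ∧ not (lookup I y))) (List.allFin n)

  Xideal : Fin g → Subset n → List (Subset n)
  Xideal a I = map (λ x → I ∪ ⁅ x ⁆) (filterᵇ (isMinOutᵇ I a) (List.allFin n))

  Xtuple : ∀ {m} → Fin g → Vec (Subset n) m → List (Vec (Subset n) m)
  Xtuple {m} a t =
    concatMap (λ j → map (λ J → t [ j ]≔ J) (Xideal a (lookup t j))) (List.allFin m)

-- finite formal ℚ-linear combinations of m-tuples of subsets of P
Combo : ℕ → ℕ → Set
Combo n m = List (ℚ × Vec (Subset n) m)

basis : ∀ {n m} → Vec (Subset n) m → Combo n m
basis t = (ℚ.1ℚ , t) ∷ []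

scale : ∀ {n m} → ℚ → Combo n m → Combo n m
scale s = map (λ { (c , t) → (s ℚ.* c , t) })

module _ {n g : ℕ} (Γ : SimpleGraph g) (P : FinPoset n) (κ : Fin n → Fin g) where

  X : ∀ {m} → Fin g → Combo n m → Combo n m
  X a = concatMap (λ { (c , t) → map (λ u → (c , u)) (Xtuple Γ P κ a t) })

  Xpow : ∀ {m} → Fin g → ℕ → Combo n m → Combo n m
  Xpow a zero    L = L
  Xpow a (suc k) L = X a (Xpow a k L)

  ⟨_^_⟩ : ∀ {m} → Fin g → ℕ → Combo n m → Combo n m
  ⟨ a ^ k ⟩ L = scale (ℚ._/_ (+ 1) (k !) {{k !≢0}}) (Xpow a k L)

  ⟨_^_,_^_,_^_⟩ : ∀ {m} → Fin g → ℕ → Fin g → ℕ → Fin g → ℕ →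
                  Combo n m → Combo n m
  ⟨ d3 ^ n3 , d2 ^ n2 , d1 ^ n1 ⟩ L = ⟨ d3 ^ n3 ⟩ (⟨ d2 ^ n2 ⟩ (⟨ d1 ^ n1 ⟩ L))

sumℚ : List ℚ → ℚ
sumℚ = foldr ℚ._+_ 0ℚ

_≟T_ : ∀ {n m} (t u : Vec (Subset n) m) → Bool
t ≟T u = ⌊ VecP.≡-dec (VecP.≡-dec BoolP._≟_) t u ⌋

coeffTuple : ∀ {n m} → Vec (Subset n) m → Combo n m → ℚ
coeffTuple u L = sumℚ (map (λ { (c , t) → c }) (filterᵇ (λ { (c , t) → t ≟T u }) L))

mult : ∀ {n m} → Subset n → Vec (Subset n) m → ℕ
mult S t = length (filterᵇ (λ T → ⌊ VecP.≡-dec BoolP._≟_ S T ⌋) (toList t))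

sameMultisetᵇ : ∀ {n m} → Vec (Subset n) m → Vec (Subset n) m → Bool
sameMultisetᵇ t u = allᵇ (λ S → mult S t ≡ᵇ mult S u) (toList t ++ toList u)

-- coefficient of the basis multiset {u} in the space of m-multisets
-- (a tuple t in a combination stands for the multiset it determines)
coeffMultiset : ∀ {n m} → Vec (Subset n) m → Combo n m → ℚ
coeffMultiset u L =
  sumℚ (map (λ { (c , t) → c }) (filterᵇ (λ { (c , t) → sameMultisetᵇ t u }) L))

_≈Tuple_ : ∀ {n m} → Combo n m → Combo n m → Set
L ≈Tuple R = ∀ u → coeffTuple u L ≡ coeffTuple u R

_≈Multiset_ : ∀ {n m} → Combo n m → Combo n m → Set
L ≈Multiset R = ∀ u → coeffMultiset u L ≡ coeffMultiset u R

ℕtoℚ : ℕ → ℚ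
ℕtoℚ k = ℚ._/_ (+ k) 1

{-# OPTIONS --safe #-}
module Submission where

-- On a single ideal I, X_a.I is 0 or one ideal (by EC), and X_a X_a and X_a X_b X_a vanish
-- (by NA, respectively ICE2). Since X_a acts on a tuple one coordinate at a time, a path from t
-- to u through c^r, b^p, c^q changes each coordinate in one of a few ways: not at all, by one
-- c-step, by one b-step, by a c-step of the first block followed by a b-step, by a b-step
-- followed by a c-step of the last block, or by either of these two. Divided by r! p! q!, the
-- number of paths is therefore 0 or 1 times a binomial coefficient counting how the free
-- c-steps are split between the first and the last block. On the right-hand side the roles of
-- b and c are exchanged, and the identity becomes Vandermonde's convolution. Equality of all
-- tuple coefficients implies equality of all multiset coefficients.

open import Defs
open import Data.Bool using (Bool; true; false; _∧_; not; T; if_then_else_)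
import Data.Bool.Properties as Bool
open import Data.Bool.Properties using (T-≡; T-∧)
open import Data.Empty using (⊥)
open import Data.Fin as Fin using (Fin)
open import Data.Fin.Subset using (Subset; _∪_; ⁅_⁆) renaming (_∈_ to _∈ˢ_; _∉_ to _∉ˢ_)
open import Data.Fin.Subset.Properties using (x∈⁅x⁆; x∈⁅y⁆⇒x≡y; x∈p∪q⁻; x∈p∪q⁺)
import Data.Integer as ℤ
import Data.Integer.Properties as ℤ
import Data.Integer.Tactic.RingSolver as ℤ-Solver
open import Data.List as List
  using (List; []; _∷_; _++_; [_]; foldr; map; concat; concatMap; replicate; filterᵇ; length;
         tabulate; allFin; deduplicate; applyUpTo; upTo)
open import Data.List.Membership.Propositional using (_∈_)
open import Data.List.Membership.Propositional.Properties
  using (∈-allFin; ∈-filter⁻; ∈-deduplicate⁺; ∈-++⁺ˡ; ∈-++⁺ʳ; ∈-map⁺)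
open import Data.List.Properties
  using (map-++; map-cong; map-cong-local; map-∘; map-tabulate; concatMap-map; map-concatMap; concatMap-++;
         concatMap-cong; concatMap-pure; ++-assoc; ++-identityʳ; filter-++; filter-none; length-++)
open import Data.List.Relation.Binary.Permutation.Propositional as ↭
  using (_↭_; prep; swap; ↭-refl; ↭-trans; ↭-reflexive; module PermutationReasoning)
open import Data.List.Relation.Binary.Permutation.Propositional.Properties
  using (++⁺; ++⁺ˡ; ++-comm; shifts; ↭-length; filter-↭)
import Data.List.Relation.Unary.All as ListAll
open import Data.List.Relation.Unary.AllPairs using (_∷_)
open import Data.List.Relation.Unary.Any using (here; there)
open import Data.List.Relation.Unary.Unique.Propositional using (Unique)
open import Data.List.Relation.Unary.Unique.Propositional.Properties using (allFin⁺)
import Data.List.Relation.Unary.Unique.DecPropositional.Properties as Unique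
open import Data.Maybe using (Maybe; just; nothing)
open import Data.Nat as ℕ
  using (ℕ; zero; suc; pred; _+_; _*_; _∸_; _≤_; _<_; _⊓_; _!; z≤n; s≤s)
open import Data.Nat.Combinatorics using (_C_; nCk+nC[k+1]≡[n+1]C[k+1]; k>n⇒nCk≡0; nCn≡1; nCk≡nC[n∸k])
open import Data.Nat.ListAction using (sum)
open import Data.Nat.Properties
open import Data.Nat.Tactic.RingSolver using (solve-∀)
open import Algebra.Properties.CommutativeSemigroup +-commutativeSemigroup
  using () renaming (x∙yz≈y∙xz to +-left-comm; interchange to +-+-interchange)
open import Algebra.Properties.CommutativeSemigroup *-commutativeSemigroup
  using () renaming (x∙yz≈y∙xz to *-left-comm)
open import Data.Product using (∃; ∃₂; _×_; _,_; proj₁; proj₂; uncurry)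
open import Data.Rational as ℚ using (ℚ; 0ℚ; 1ℚ; toℚᵘ)
import Data.Rational.Properties as ℚ
open import Data.Rational.Solver using (module +-*-Solver)
import Data.Rational.Unnormalised as ℚᵘ
import Data.Rational.Unnormalised.Properties as ℚᵘ
open import Data.Sum using (_⊎_; inj₁; inj₂)
open import Data.Vec as Vec using (Vec; []; _∷_; lookup; _[_]≔_)
import Data.Vec.Properties as Vec
open import Data.Vec.Properties using ([]=⇒lookup; lookup⇒[]=; ∷-injective)
open import Data.Vec.Relation.Unary.All using (All; []; _∷_)
open import Function using (_∘_; Equivalence; mk⇔; case_of_)
open import Relation.Nullary using (¬_; Dec; yes; no; ⌊_⌋; _×-dec_; contradiction)
open import Relation.Nullary.Decidable using (toWitness; toWitnessFalse; T?; isYes≗does; does-⇔; dec-true; dec-false)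
open import Relation.Binary.PropositionalEquality hiding ([_])

-- Finite sums and Vandermonde's convolution

sumBelow : ℕ → (ℕ → ℕ) → ℕ
sumBelow zero    f = 0
sumBelow (suc n) f = f 0 + sumBelow n (f ∘ suc)

sumBelow-cong : ∀ n {f h : ℕ → ℕ} → (∀ j → j < n → f j ≡ h j) → sumBelow n f ≡ sumBelow n h
sumBelow-cong zero    e = refl
sumBelow-cong (suc n) e = cong₂ _+_ (e 0 (s≤s z≤n)) (sumBelow-cong n (λ j j<n → e (suc j) (s≤s j<n)))

sumBelow-zero : ∀ n {f : ℕ → ℕ} → (∀ j → j < n → f j ≡ 0) → sumBelow n f ≡ 0
sumBelow-zero n {f} e = trans (sumBelow-cong n e) (lemma n)
  where
  lemma : ∀ n → sumBelow n (λ _ → 0) ≡ 0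
  lemma zero    = refl
  lemma (suc n) = lemma n

sumBelow-+ : ∀ m n (f : ℕ → ℕ) → sumBelow (m + n) f ≡ sumBelow m f + sumBelow n (f ∘ (m +_))
sumBelow-+ zero    n f = refl
sumBelow-+ (suc m) n f = trans (cong (f 0 +_) (sumBelow-+ m n (f ∘ suc))) (sym (+-assoc (f 0) _ _))

sumBelow-*ˡ : ∀ n c (f : ℕ → ℕ) → sumBelow n (λ j → c * f j) ≡ c * sumBelow n f
sumBelow-*ˡ zero    c f = sym (*-zeroʳ c)
sumBelow-*ˡ (suc n) c f =
  trans (cong (c * f 0 +_) (sumBelow-*ˡ n c (f ∘ suc))) (sym (*-distribˡ-+ c (f 0) _))

sumBelow-distrib : ∀ n (f h : ℕ → ℕ) → sumBelow n (λ j → f j + h j) ≡ sumBelow n f + sumBelow n h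
sumBelow-distrib zero    f h = refl
sumBelow-distrib (suc n) f h =
  trans (cong (f 0 + h 0 +_) (sumBelow-distrib n (f ∘ suc) (h ∘ suc))) (+-+-interchange (f 0) (h 0) _ _)

sumBelow-pad : ∀ {m n} (f : ℕ → ℕ) → m ≤ n → (∀ j → m ≤ j → j < n → f j ≡ 0) →
               sumBelow m f ≡ sumBelow n f
sumBelow-pad {m} {n} f m≤n tail≡0 = begin
  sumBelow m f                                        ≡⟨ +-identityʳ _ ⟨
  sumBelow m f + 0                                    ≡⟨ cong (sumBelow m f +_) (sumBelow-zero (n ∸ m) tail) ⟨
  sumBelow m f + sumBelow (n ∸ m) (f ∘ (m +_))        ≡⟨ sumBelow-+ m (n ∸ m) f ⟨
  sumBelow (m + (n ∸ m)) f                            ≡⟨ cong (λ k → sumBelow k f) (m+[n∸m]≡n m≤n) ⟩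
  sumBelow n f                                        ∎
  where
  open ≡-Reasoning
  tail : ∀ j → j < n ∸ m → f (m + j) ≡ 0
  tail j j<n∸m = tail≡0 (m + j) (m≤m+n m j)
    (subst (m + j <_) (m+[n∸m]≡n m≤n) (+-monoʳ-< m j<n∸m))

vandermonde : ∀ A B a → sumBelow (suc a) (λ j → (A C (a ∸ j)) * (B C j)) ≡ (A + B) C a
vandermonde A zero a =
  trans (cong ((A C a) * 1 +_) (sumBelow-zero a (λ j _ → *-zeroʳ (A C (a ∸ suc j)))))
  (trans (+-identityʳ _) (trans (*-identityʳ _) (cong (_C a) (sym (+-identityʳ A)))))
vandermonde A (suc B) zero = cong (_C 0) (+-suc A B)
vandermonde A (suc B) (suc a) = begin
  (A C suc a) * 1 + sumBelow (suc a) (λ j → (A C (a ∸ j)) * (suc B C suc j))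
    ≡⟨ cong ((A C suc a) * 1 +_) (sumBelow-cong (suc a) (λ j _ → pascal-split j)) ⟩
  (A C suc a) * 1 + sumBelow (suc a) (λ j → (A C (a ∸ j)) * (B C j) + (A C (a ∸ j)) * (B C suc j))
    ≡⟨ cong ((A C suc a) * 1 +_)
            (sumBelow-distrib (suc a) (λ j → (A C (a ∸ j)) * (B C j)) (λ j → (A C (a ∸ j)) * (B C suc j))) ⟩
  (A C suc a) * 1 + (conv a + sumBelow (suc a) (λ j → (A C (a ∸ j)) * (B C suc j)))
    ≡⟨ +-left-comm ((A C suc a) * 1) (conv a) _ ⟩
  conv a + conv (suc a)
    ≡⟨ cong₂ _+_ (vandermonde A B a) (vandermonde A B (suc a)) ⟩
  ((A + B) C a) + ((A + B) C suc a)
    ≡⟨ nCk+nC[k+1]≡[n+1]C[k+1] (A + B) a ⟩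
  suc (A + B) C suc a
    ≡⟨ cong (_C suc a) (+-suc A B) ⟨
  (A + suc B) C suc a ∎
  where
  open ≡-Reasoning
  conv : ℕ → ℕ
  conv a = sumBelow (suc a) (λ j → (A C (a ∸ j)) * (B C j))
  pascal-split : ∀ j → (A C (a ∸ j)) * (suc B C suc j) ≡ (A C (a ∸ j)) * (B C j) + (A C (a ∸ j)) * (B C suc j)
  pascal-split j = trans (cong ((A C (a ∸ j)) *_) (sym (nCk+nC[k+1]≡[n+1]C[k+1] B j)))
                         (*-distribˡ-+ (A C (a ∸ j)) (B C j) (B C suc j))

-- Counting paths coordinate by coordinate

-- How a coordinate passes from tᵢ to uᵢ under X_a^k₁, then X_b^k₂, then X_a^k₃: via-ab takes an
-- a-step of the first block and then a b-step, via-ba a b-step and then an a-step of the last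
-- block, via-ab-ba either of these.
data Route : Set where
  stay via-a via-b via-ab via-ba via-ab-ba unreachable : Route

swapRoute : Route → Route
swapRoute stay        = stay
swapRoute via-a       = via-b
swapRoute via-b       = via-a
swapRoute via-ab      = via-ba
swapRoute via-ba      = via-ab
swapRoute via-ab-ba   = via-ab-ba
swapRoute unreachable = unreachable

δ : ℕ → ℕ → ℕ
δ zero    zero    = 1
δ zero    (suc _) = 0
δ (suc _) zero    = 0
δ (suc a) (suc b) = δ a b

δ-refl : ∀ a → δ a a ≡ 1
δ-refl zero    = refl
δ-refl (suc a) = δ-refl a

δ-≢ : ∀ {a b} → a ≢ b → δ a b ≡ 0
δ-≢ {zero}  {zero}  a≢b = contradiction refl a≢b
δ-≢ {zero}  {suc b} a≢b = refl
δ-≢ {suc a} {zero}  a≢b = refl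
δ-≢ {suc a} {suc b} a≢b = δ-≢ (a≢b ∘ cong suc)

δ≢0⇒≡ : ∀ a b → δ a b ≢ 0 → a ≡ b
δ≢0⇒≡ a b δ≢0 with a ≟ b
... | yes a≡b = a≡b
... | no  a≢b = contradiction (δ-≢ a≢b) δ≢0

-- f (k ∸ 1), except that the value at k = 0 is 0 rather than f 0.
atPred : ℕ → (ℕ → ℕ) → ℕ
atPred zero    f = 0
atPred (suc k) f = f k

atPred-cong : ∀ k {f h : ℕ → ℕ} → (∀ j → f j ≡ h j) → atPred k f ≡ atPred k h
atPred-cong zero    e = refl
atPred-cong (suc k) e = e k

atPred-map : ∀ k (h : ℕ → ℕ) → h 0 ≡ 0 → (f : ℕ → ℕ) → atPred k (h ∘ f) ≡ h (atPred k f)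
atPred-map zero    h h0≡0 f = sym h0≡0
atPred-map (suc k) h h0≡0 f = refl

atPred-+ : ∀ k (f h : ℕ → ℕ) → atPred k (λ j → f j + h j) ≡ atPred k f + atPred k h
atPred-+ zero    f h = refl
atPred-+ (suc k) f h = refl

atPred-comm : ∀ k₁ k₂ (F : ℕ → ℕ → ℕ) →
              atPred k₁ (λ i → atPred k₂ (F i)) ≡ atPred k₂ (λ j → atPred k₁ (λ i → F i j))
atPred-comm zero    zero    F = refl
atPred-comm zero    (suc _) F = refl
atPred-comm (suc _) zero    F = refl
atPred-comm (suc _) (suc _) F = refl

δ-suc : ∀ k m → δ k (suc m) ≡ atPred k (λ j → δ j m)
δ-suc zero    m = refl
δ-suc (suc k) m = refl

-- N k₁ k₂ k₃ counts paths through X_a^k₁, then X_b^k₂, then X_a^k₃.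
Counts : Set
Counts = ℕ → ℕ → ℕ → ℕ

pathStep : Route → Counts → Counts
pathStep stay        N k₁ k₂ k₃ = N k₁ k₂ k₃
pathStep via-a       N k₁ k₂ k₃ = k₁ * N (pred k₁) k₂ k₃ + k₃ * N k₁ k₂ (pred k₃)
pathStep via-b       N k₁ k₂ k₃ = k₂ * N k₁ (pred k₂) k₃
pathStep via-ab      N k₁ k₂ k₃ = k₁ * (k₂ * N (pred k₁) (pred k₂) k₃)
pathStep via-ba      N k₁ k₂ k₃ = k₂ * (k₃ * N k₁ (pred k₂) (pred k₃))
pathStep via-ab-ba   N k₁ k₂ k₃ = pathStep via-ab N k₁ k₂ k₃ + pathStep via-ba N k₁ k₂ k₃
pathStep unreachable N k₁ k₂ k₃ = 0

normStep : Route → Counts → Counts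
normStep stay        N k₁ k₂ k₃ = N k₁ k₂ k₃
normStep via-a       N k₁ k₂ k₃ = atPred k₁ (λ i → N i k₂ k₃) + atPred k₃ (N k₁ k₂)
normStep via-b       N k₁ k₂ k₃ = atPred k₂ (λ j → N k₁ j k₃)
normStep via-ab      N k₁ k₂ k₃ = atPred k₁ (λ i → atPred k₂ (λ j → N i j k₃))
normStep via-ba      N k₁ k₂ k₃ = atPred k₂ (λ j → atPred k₃ (N k₁ j))
normStep via-ab-ba   N k₁ k₂ k₃ = normStep via-ab N k₁ k₂ k₃ + normStep via-ba N k₁ k₂ k₃
normStep unreachable N k₁ k₂ k₃ = 0

δ₀ : Counts
δ₀ k₁ k₂ k₃ = δ k₁ 0 * (δ k₂ 0 * δ k₃ 0)

pathCount normCount : List Route → Counts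
pathCount = foldr pathStep δ₀
normCount = foldr normStep δ₀

scaled : ℕ → ℕ → ℕ → ℕ → ℕ
scaled k₁ k₂ k₃ x = k₁ ! * (k₂ ! * (k₃ ! * x))

scaled-+ : ∀ k₁ k₂ k₃ x y → scaled k₁ k₂ k₃ (x + y) ≡ scaled k₁ k₂ k₃ x + scaled k₁ k₂ k₃ y
scaled-+ k₁ k₂ k₃ x y = distrib (k₁ !) (k₂ !) (k₃ !) x y
  where
  distrib : ∀ a b c x y → a * (b * (c * (x + y))) ≡ a * (b * (c * x)) + a * (b * (c * y))
  distrib = solve-∀

scaled-zero : ∀ k₁ k₂ k₃ → scaled k₁ k₂ k₃ 0 ≡ 0
scaled-zero k₁ k₂ k₃ = annihilate (k₁ !) (k₂ !) (k₃ !)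
  where
  annihilate : ∀ a b c → a * (b * (c * 0)) ≡ 0
  annihilate = solve-∀

*-pred-! : ∀ k (X : ℕ → ℕ) → k * (pred k ! * X (pred k)) ≡ k ! * atPred k X
*-pred-! zero    X = refl
*-pred-! (suc k) X = sym (*-assoc (suc k) (k !) (X k))

private
  atPred-*ˡ : ∀ k c (X : ℕ → ℕ) → atPred k (λ i → c * X i) ≡ c * atPred k X
  atPred-*ˡ k c = atPred-map k (c *_) (*-zeroʳ c)

scaled-pred₁ : ∀ k₁ k₂ k₃ (X : ℕ → ℕ) →
               k₁ * scaled (pred k₁) k₂ k₃ (X (pred k₁)) ≡ scaled k₁ k₂ k₃ (atPred k₁ X)
scaled-pred₁ k₁ k₂ k₃ X = trans (*-pred-! k₁ (λ i → k₂ ! * (k₃ ! * X i)))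
  (cong (k₁ ! *_) (trans (atPred-*ˡ k₁ (k₂ !) (λ i → k₃ ! * X i)) (cong (k₂ ! *_) (atPred-*ˡ k₁ (k₃ !) X))))

scaled-pred₂ : ∀ k₁ k₂ k₃ (X : ℕ → ℕ) →
               k₂ * scaled k₁ (pred k₂) k₃ (X (pred k₂)) ≡ scaled k₁ k₂ k₃ (atPred k₂ X)
scaled-pred₂ k₁ k₂ k₃ X = trans (*-left-comm k₂ (k₁ !) _)
  (cong (k₁ ! *_) (trans (*-pred-! k₂ (λ j → k₃ ! * X j)) (cong (k₂ ! *_) (atPred-*ˡ k₂ (k₃ !) X))))

scaled-pred₃ : ∀ k₁ k₂ k₃ (X : ℕ → ℕ) →
               k₃ * scaled k₁ k₂ (pred k₃) (X (pred k₃)) ≡ scaled k₁ k₂ k₃ (atPred k₃ X)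
scaled-pred₃ k₁ k₂ k₃ X = trans (*-left-comm k₃ (k₁ !) _)
  (cong (k₁ ! *_) (trans (*-left-comm k₃ (k₂ !) _) (cong (k₂ ! *_) (*-pred-! k₃ X))))

scaled-pred₁₂ : ∀ k₁ k₂ k₃ (X : ℕ → ℕ → ℕ) →
                k₁ * (k₂ * scaled (pred k₁) (pred k₂) k₃ (X (pred k₁) (pred k₂)))
                ≡ scaled k₁ k₂ k₃ (atPred k₁ (λ i → atPred k₂ (X i)))
scaled-pred₁₂ k₁ k₂ k₃ X = trans (cong (k₁ *_) (scaled-pred₂ (pred k₁) k₂ k₃ (X (pred k₁))))
                                 (scaled-pred₁ k₁ k₂ k₃ (λ i → atPred k₂ (X i)))

scaled-pred₂₃ : ∀ k₁ k₂ k₃ (X : ℕ → ℕ → ℕ) →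
                k₂ * (k₃ * scaled k₁ (pred k₂) (pred k₃) (X (pred k₂) (pred k₃)))
                ≡ scaled k₁ k₂ k₃ (atPred k₂ (λ j → atPred k₃ (X j)))
scaled-pred₂₃ k₁ k₂ k₃ X = trans (cong (k₂ *_) (scaled-pred₃ k₁ (pred k₂) k₃ (X (pred k₂))))
                                 (scaled-pred₂ k₁ k₂ k₃ (λ j → atPred k₃ (X j)))

pathStep-scaled : ∀ τ {N M : Counts} → (∀ k₁ k₂ k₃ → N k₁ k₂ k₃ ≡ scaled k₁ k₂ k₃ (M k₁ k₂ k₃)) →
              ∀ k₁ k₂ k₃ → pathStep τ N k₁ k₂ k₃ ≡ scaled k₁ k₂ k₃ (normStep τ M k₁ k₂ k₃)
pathStep-scaled stay N≡ k₁ k₂ k₃ = N≡ k₁ k₂ k₃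
pathStep-scaled via-a {N} {M} N≡ k₁ k₂ k₃ = begin
  k₁ * N (pred k₁) k₂ k₃ + k₃ * N k₁ k₂ (pred k₃)
    ≡⟨ cong₂ _+_ (cong (k₁ *_) (N≡ (pred k₁) k₂ k₃)) (cong (k₃ *_) (N≡ k₁ k₂ (pred k₃))) ⟩
  k₁ * scaled (pred k₁) k₂ k₃ (M (pred k₁) k₂ k₃) + k₃ * scaled k₁ k₂ (pred k₃) (M k₁ k₂ (pred k₃))
    ≡⟨ cong₂ _+_ (scaled-pred₁ k₁ k₂ k₃ (λ i → M i k₂ k₃)) (scaled-pred₃ k₁ k₂ k₃ (M k₁ k₂)) ⟩
  scaled k₁ k₂ k₃ (atPred k₁ (λ i → M i k₂ k₃)) + scaled k₁ k₂ k₃ (atPred k₃ (M k₁ k₂))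
    ≡⟨ scaled-+ k₁ k₂ k₃ _ _ ⟨
  scaled k₁ k₂ k₃ (normStep via-a M k₁ k₂ k₃) ∎
  where open ≡-Reasoning
pathStep-scaled via-b N≡ k₁ k₂ k₃ =
  trans (cong (k₂ *_) (N≡ k₁ (pred k₂) k₃)) (scaled-pred₂ k₁ k₂ k₃ _)
pathStep-scaled via-ab N≡ k₁ k₂ k₃ =
  trans (cong (λ n → k₁ * (k₂ * n)) (N≡ (pred k₁) (pred k₂) k₃)) (scaled-pred₁₂ k₁ k₂ k₃ _)
pathStep-scaled via-ba N≡ k₁ k₂ k₃ =
  trans (cong (λ n → k₂ * (k₃ * n)) (N≡ k₁ (pred k₂) (pred k₃))) (scaled-pred₂₃ k₁ k₂ k₃ _)
pathStep-scaled via-ab-ba N≡ k₁ k₂ k₃ =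
  trans (cong₂ _+_ (pathStep-scaled via-ab N≡ k₁ k₂ k₃) (pathStep-scaled via-ba N≡ k₁ k₂ k₃))
        (sym (scaled-+ k₁ k₂ k₃ _ _))
pathStep-scaled unreachable N≡ k₁ k₂ k₃ = sym (scaled-zero k₁ k₂ k₃)

δ₀-scaled : ∀ k₁ k₂ k₃ → δ₀ k₁ k₂ k₃ ≡ scaled k₁ k₂ k₃ (δ₀ k₁ k₂ k₃)
δ₀-scaled zero    zero    zero    = refl
δ₀-scaled zero    zero    (suc k) = sym (scaled-zero 0 0 (suc k))
δ₀-scaled zero    (suc k) k₃      = sym (scaled-zero 0 (suc k) k₃)
δ₀-scaled (suc k) k₂      k₃      = sym (scaled-zero (suc k) k₂ k₃)

pathCount≡scaled-normCount : ∀ τs k₁ k₂ k₃ → pathCount τs k₁ k₂ k₃ ≡ scaled k₁ k₂ k₃ (normCount τs k₁ k₂ k₃)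
pathCount≡scaled-normCount []       = δ₀-scaled
pathCount≡scaled-normCount (τ ∷ τs) = pathStep-scaled τ (pathCount≡scaled-normCount τs)

-- Closed form of the normalised count

-- live is 0 if some coordinate is unreachable and 1 otherwise.
record Tally : Set where
  field
    nA nB nAB nBA nBoth live : ℕ

open Tally

tallyStep : Route → Tally → Tally
tallyStep stay        T = T
tallyStep via-a       T = record T { nA    = suc (nA T) }
tallyStep via-b       T = record T { nB    = suc (nB T) }
tallyStep via-ab      T = record T { nAB   = suc (nAB T) }
tallyStep via-ba      T = record T { nBA   = suc (nBA T) }
tallyStep via-ab-ba   T = record T { nBoth = suc (nBoth T) }
tallyStep unreachable T = record T { live  = 0 }

tallyOf : List Route → Tally
tallyOf = foldr tallyStep (record { nA = 0 ; nB = 0 ; nAB = 0 ; nBA = 0 ; nBoth = 0 ; live = 1 })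

swapTally : Tally → Tally
swapTally T = record T { nA = nB T ; nB = nA T ; nAB = nBA T ; nBA = nAB T }

tallyStep-swap : ∀ τ T → tallyStep (swapRoute τ) (swapTally T) ≡ swapTally (tallyStep τ T)
tallyStep-swap stay        T = refl
tallyStep-swap via-a       T = refl
tallyStep-swap via-b       T = refl
tallyStep-swap via-ab      T = refl
tallyStep-swap via-ba      T = refl
tallyStep-swap via-ab-ba   T = refl
tallyStep-swap unreachable T = refl

tallyOf-swap : ∀ τs → tallyOf (map swapRoute τs) ≡ swapTally (tallyOf τs)
tallyOf-swap []       = refl
tallyOf-swap (τ ∷ τs) =
  trans (cong (tallyStep (swapRoute τ)) (tallyOf-swap τs)) (tallyStep-swap τ (tallyOf τs))

-- The number of ways to place the a-steps of the coordinates in the first or the last block,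
-- with k₁ and k₃ a-steps there, when y of them must go first, x last, and f are free.
placements : (k₁ k₃ y x f : ℕ) → ℕ
placements k₁ k₃ (suc y) x       f       = atPred k₁ (λ i → placements i k₃ y x f)
placements k₁ k₃ zero    (suc x) f       = atPred k₃ (λ j → placements k₁ j zero x f)
placements k₁ k₃ zero    zero    zero    = δ k₁ 0 * δ k₃ 0
placements k₁ k₃ zero    zero    (suc f) =
  atPred k₁ (λ i → placements i k₃ 0 0 f) + atPred k₃ (λ j → placements k₁ j 0 0 f)

placements-suc-x : ∀ y k₁ k₃ x f → placements k₁ k₃ y (suc x) f ≡ atPred k₃ (λ j → placements k₁ j y x f)
placements-suc-x zero    k₁ k₃ x f = refl
placements-suc-x (suc y) k₁ k₃ x f =
  trans (atPred-cong k₁ (λ i → placements-suc-x y i k₃ x f)) (atPred-comm k₁ k₃ (λ i j → placements i j y x f))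

placements-suc-f : ∀ y x k₁ k₃ f → placements k₁ k₃ y x (suc f)
                   ≡ atPred k₁ (λ i → placements i k₃ y x f) + atPred k₃ (λ j → placements k₁ j y x f)
placements-suc-f zero    zero    k₁ k₃ f = refl
placements-suc-f zero    (suc x) k₁ k₃ f =
  trans (atPred-cong k₃ (λ j → placements-suc-f zero x k₁ j f))
  (trans (atPred-+ k₃ _ _) (cong₂ _+_ (sym (atPred-comm k₁ k₃ (λ i j → placements i j zero x f))) refl))
placements-suc-f (suc y) x       k₁ k₃ f =
  trans (atPred-cong k₁ (λ i → placements-suc-f y x i k₃ f))
  (trans (atPred-+ k₁ _ _) (cong₂ _+_ refl (atPred-comm k₁ k₃ (λ i j → placements i j y x f))))

usesB : Tally → ℕ
usesB T = nB T + (nAB T + (nBA T + nBoth T))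

closedForm : Tally → Counts
closedForm T k₁ k₂ k₃ = live T * (δ k₂ (usesB T) * placements k₁ k₃ (nAB T) (nBA T) (nA T + nBoth T))

normStep-cong : ∀ τ {M M′ : Counts} → (∀ k₁ k₂ k₃ → M k₁ k₂ k₃ ≡ M′ k₁ k₂ k₃) →
                ∀ k₁ k₂ k₃ → normStep τ M k₁ k₂ k₃ ≡ normStep τ M′ k₁ k₂ k₃
normStep-cong stay        e k₁ k₂ k₃ = e k₁ k₂ k₃
normStep-cong via-a       e k₁ k₂ k₃ =
  cong₂ _+_ (atPred-cong k₁ (λ i → e i k₂ k₃)) (atPred-cong k₃ (e k₁ k₂))
normStep-cong via-b       e k₁ k₂ k₃ = atPred-cong k₂ (λ j → e k₁ j k₃)
normStep-cong via-ab      e k₁ k₂ k₃ = atPred-cong k₁ (λ i → atPred-cong k₂ (λ j → e i j k₃))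
normStep-cong via-ba      e k₁ k₂ k₃ = atPred-cong k₂ (λ j → atPred-cong k₃ (e k₁ j))
normStep-cong via-ab-ba   e k₁ k₂ k₃ =
  cong₂ _+_ (normStep-cong via-ab e k₁ k₂ k₃) (normStep-cong via-ba e k₁ k₂ k₃)
normStep-cong unreachable e k₁ k₂ k₃ = refl

private
  atPred-δ : ∀ k U c w → atPred k (λ j → c * (δ j U * w)) ≡ c * (δ k (suc U) * w)
  atPred-δ k U c w = trans (atPred-map k (λ z → c * (z * w)) (*-zeroʳ c) (λ j → δ j U))
                           (cong (λ d → c * (d * w)) (sym (δ-suc k U)))

  atPred-scale : ∀ k c d (f : ℕ → ℕ) → atPred k (λ j → c * (d * f j)) ≡ c * (d * atPred k f)
  atPred-scale k c d = atPred-map k (λ z → c * (d * z)) (trans (cong (c *_) (*-zeroʳ d)) (*-zeroʳ c))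

  suc-inside₂ : ∀ a b c d → a + (suc b + (c + d)) ≡ suc (a + (b + (c + d)))
  suc-inside₂ = solve-∀

  suc-inside₃ : ∀ a b c d → a + (b + (suc c + d)) ≡ suc (a + (b + (c + d)))
  suc-inside₃ = solve-∀

  suc-inside₄ : ∀ a b c d → a + (b + (c + suc d)) ≡ suc (a + (b + (c + d)))
  suc-inside₄ = solve-∀

module _ (T : Tally) (k₁ k₂ k₃ : ℕ) where
  private
    P : ℕ → ℕ → ℕ
    P i j = placements i j (nAB T) (nBA T) (nA T + nBoth T)

    ab-shape : normStep via-ab (closedForm T) k₁ k₂ k₃ ≡ live T * (δ k₂ (suc (usesB T)) * atPred k₁ (λ i → P i k₃))
    ab-shape = trans (atPred-cong k₁ (λ i → atPred-δ k₂ (usesB T) (live T) (P i k₃)))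
                     (atPred-scale k₁ (live T) (δ k₂ (suc (usesB T))) (λ i → P i k₃))

    ba-shape : normStep via-ba (closedForm T) k₁ k₂ k₃ ≡ live T * (δ k₂ (suc (usesB T)) * atPred k₃ (P k₁))
    ba-shape = trans (atPred-cong k₂ (λ j → atPred-scale k₃ (live T) (δ j (usesB T)) (P k₁)))
                     (atPred-δ k₂ (usesB T) (live T) (atPred k₃ (P k₁)))

  normStep-closedForm : ∀ τ → normStep τ (closedForm T) k₁ k₂ k₃ ≡ closedForm (tallyStep τ T) k₁ k₂ k₃
  normStep-closedForm stay        = refl
  normStep-closedForm unreachable = refl
  normStep-closedForm via-a =
    trans (cong₂ _+_ (atPred-scale k₁ (live T) (δ k₂ (usesB T)) (λ i → P i k₃))
                     (atPred-scale k₃ (live T) (δ k₂ (usesB T)) (P k₁)))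
    (trans (sym (*-distribˡ-+ (live T) _ _))
    (cong (live T *_) (trans (sym (*-distribˡ-+ (δ k₂ (usesB T)) _ _))
                             (cong (δ k₂ (usesB T) *_) (sym (placements-suc-f (nAB T) (nBA T) k₁ k₃ (nA T + nBoth T)))))))
  normStep-closedForm via-b = atPred-δ k₂ (usesB T) (live T) (P k₁ k₃)
  normStep-closedForm via-ab =
    trans ab-shape (cong (λ u → live T * (δ k₂ u * atPred k₁ (λ i → P i k₃)))
                         (sym (suc-inside₂ (nB T) (nAB T) (nBA T) (nBoth T))))
  normStep-closedForm via-ba =
    trans ba-shape (cong₂ (λ u w → live T * (δ k₂ u * w)) (sym (suc-inside₃ (nB T) (nAB T) (nBA T) (nBoth T)))
                          (sym (placements-suc-x (nAB T) k₁ k₃ (nBA T) _)))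
  normStep-closedForm via-ab-ba =
    trans (cong₂ _+_ ab-shape ba-shape)
    (trans (sym (*-distribˡ-+ (live T) _ _))
    (cong (live T *_) (trans (sym (*-distribˡ-+ (δ k₂ (suc (usesB T))) _ _))
      (cong₂ (λ u w → δ k₂ u * w) (sym (suc-inside₄ (nB T) (nAB T) (nBA T) (nBoth T)))
             (trans (sym (placements-suc-f (nAB T) (nBA T) k₁ k₃ _))
                    (cong (placements k₁ k₃ (nAB T) (nBA T)) (sym (+-suc (nA T) (nBoth T)))))))))

normCount≡closedForm : ∀ τs k₁ k₂ k₃ → normCount τs k₁ k₂ k₃ ≡ closedForm (tallyOf τs) k₁ k₂ k₃
normCount≡closedForm [] k₁ k₂ k₃ = rearrange (δ k₁ 0) (δ k₂ 0) (δ k₃ 0)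
  where
  rearrange : ∀ x y z → x * (y * z) ≡ 1 * (y * (x * z))
  rearrange = solve-∀
normCount≡closedForm (τ ∷ τs) k₁ k₂ k₃ =
  trans (normStep-cong τ (normCount≡closedForm τs) k₁ k₂ k₃) (normStep-closedForm (tallyOf τs) k₁ k₂ k₃ τ)

-- The binomial exchange

data BelowOrShift (y : ℕ) : ℕ → Set where
  below   : ∀ {k} → k < y → BelowOrShift y k
  shifted : ∀ i → BelowOrShift y (y + i)

belowOrShift : ∀ y k → BelowOrShift y k
belowOrShift zero    k       = shifted k
belowOrShift (suc y) zero    = below (s≤s z≤n)
belowOrShift (suc y) (suc k) with belowOrShift y k
... | below k<y = below (s≤s k<y)
... | shifted i = shifted i

placements-below-y : ∀ {y k₁} k₃ x f → k₁ < y → placements k₁ k₃ y x f ≡ 0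
placements-below-y {suc y} {zero}   k₃ x f _         = refl
placements-below-y {suc y} {suc k₁} k₃ x f (s≤s k₁<y) = placements-below-y k₃ x f k₁<y

placements-shift-y : ∀ y i k₃ x f → placements (y + i) k₃ y x f ≡ placements i k₃ 0 x f
placements-shift-y zero    i k₃ x f = refl
placements-shift-y (suc y) i k₃ x f = placements-shift-y y i k₃ x f

placements-below-x : ∀ {x k₃} k₁ y f → k₃ < x → placements k₁ k₃ y x f ≡ 0
placements-below-x {suc x} {zero}   k₁ y f _ = placements-suc-x y k₁ zero x f
placements-below-x {suc x} {suc k₃} k₁ y f (s≤s k₃<x) =
  trans (placements-suc-x y k₁ (suc k₃) x f) (placements-below-x k₁ y f k₃<x)

placements-shift-x : ∀ x i k₁ y f → placements k₁ (x + i) y x f ≡ placements k₁ i y 0 f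
placements-shift-x zero    i k₁ y f = refl
placements-shift-x (suc x) i k₁ y f =
  trans (placements-suc-x y k₁ (suc (x + i)) x f) (placements-shift-x x i k₁ y f)

placements-free : ∀ i j f → placements i j 0 0 f ≡ δ (i + j) f * ((i + j) C j)
placements-free zero    zero    zero    = refl
placements-free zero    (suc j) zero    = refl
placements-free (suc i) j       zero    = refl
placements-free zero    zero    (suc f) = refl
placements-free (suc i) zero    (suc f) = trans (+-identityʳ _) (placements-free i zero f)
placements-free zero    (suc j) (suc f) =
  trans (placements-free zero j f) (cong (δ j f *_) (trans (nCn≡1 j) (sym (nCn≡1 (suc j)))))
placements-free (suc i) (suc j) (suc f) = begin
  placements i (suc j) 0 0 f + placements (suc i) j 0 0 f
    ≡⟨ cong₂ _+_ (placements-free i (suc j) f) (placements-free (suc i) j f) ⟩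
  δ (i + suc j) f * ((i + suc j) C suc j) + δ (suc (i + j)) f * (suc (i + j) C j)
    ≡⟨ cong (λ n → δ n f * (n C suc j) + δ (suc (i + j)) f * (suc (i + j) C j)) (+-suc i j) ⟩
  δ (suc (i + j)) f * (suc (i + j) C suc j) + δ (suc (i + j)) f * (suc (i + j) C j)
    ≡⟨ factor (δ (suc (i + j)) f) _ _ ⟩
  δ (suc (i + j)) f * ((suc (i + j) C j) + (suc (i + j) C suc j))
    ≡⟨ cong (δ (suc (i + j)) f *_) (nCk+nC[k+1]≡[n+1]C[k+1] (suc (i + j)) j) ⟩
  δ (suc (i + j)) f * (suc (suc (i + j)) C suc j)
    ≡⟨ cong (λ n → δ n f * (suc n C suc j)) (+-suc i j) ⟨
  δ (i + suc j) f * (suc (i + suc j) C suc j) ∎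
  where
  open ≡-Reasoning
  factor : ∀ d a b → d * a + d * b ≡ d * (b + a)
  factor = solve-∀

placements-support : ∀ k₁ k₃ y x f → placements k₁ k₃ y x f ≢ 0 → k₁ + k₃ ≡ y + x + f
placements-support k₁ k₃ y x f W≢0 with belowOrShift y k₁
... | below k₁<y = contradiction (placements-below-y k₃ x f k₁<y) W≢0
... | shifted i with belowOrShift x k₃
...   | below k₃<x = contradiction (placements-below-x (y + i) y f k₃<x) W≢0
...   | shifted j = trans (regroup y i x j) (cong (y + x +_) i+j≡f)
  where
  regroup : ∀ y i x j → y + i + (x + j) ≡ y + x + (i + j)
  regroup = solve-∀
  i+j≡f : i + j ≡ f
  i+j≡f = δ≢0⇒≡ (i + j) f λ δ≡0 → W≢0 (begin
    placements (y + i) (x + j) y x f ≡⟨ placements-shift-y y i (x + j) x f ⟩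
    placements i (x + j) 0 x f       ≡⟨ placements-shift-x x j i 0 f ⟩
    placements i j 0 0 f             ≡⟨ placements-free i j f ⟩
    δ (i + j) f * ((i + j) C j)      ≡⟨ cong (_* ((i + j) C j)) δ≡0 ⟩
    0                                ∎)
    where open ≡-Reasoning

placements-binomial : ∀ D y j → placements j ((D + y) ∸ j) 0 y D ≡ D C j
placements-binomial D y j with belowOrShift j D
... | shifted c = begin
  placements j ((j + c + y) ∸ j) 0 y (j + c)  ≡⟨ cong (λ k₃ → placements j k₃ 0 y (j + c)) k₃≡y+c ⟩
  placements j (y + c) 0 y (j + c)            ≡⟨ placements-shift-x y c j 0 (j + c) ⟩
  placements j c 0 0 (j + c)                  ≡⟨ placements-free j c (j + c) ⟩
  δ (j + c) (j + c) * ((j + c) C c)           ≡⟨ cong (_* ((j + c) C c)) (δ-refl (j + c)) ⟩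
  1 * ((j + c) C c)                           ≡⟨ *-identityˡ _ ⟩
  (j + c) C c                                 ≡⟨ cong ((j + c) C_) (m+n∸m≡n j c) ⟨
  (j + c) C ((j + c) ∸ j)                     ≡⟨ nCk≡nC[n∸k] (m≤m+n j c) ⟨
  (j + c) C j                                 ∎
  where
  open ≡-Reasoning
  k₃≡y+c : (j + c + y) ∸ j ≡ y + c
  k₃≡y+c = trans (cong (_∸ j) (+-assoc j c y)) (trans (m+n∸m≡n j (c + y)) (+-comm c y))
... | below D<j with (D + y) ∸ j | belowOrShift y ((D + y) ∸ j)
...   | _ | below k₃<y = trans (placements-below-x j 0 D k₃<y) (sym (k>n⇒nCk≡0 D<j))
...   | _ | shifted c  = begin
  placements j (y + c) 0 y D   ≡⟨ placements-shift-x y c j 0 D ⟩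
  placements j c 0 0 D         ≡⟨ placements-free j c D ⟩
  δ (j + c) D * ((j + c) C c)  ≡⟨ cong (_* ((j + c) C c))
                                        (δ-≢ (λ j+c≡D → <⇒≱ D<j (≤-trans (m≤m+n j c) (≤-reflexive j+c≡D)))) ⟩
  0                            ≡⟨ k>n⇒nCk≡0 D<j ⟨
  D C j                        ∎
  where open ≡-Reasoning

private
  c*[d*0]≡0 : ∀ c d → c * (d * 0) ≡ 0
  c*[d*0]≡0 c d = trans (cong (c *_) (*-zeroʳ d)) (*-zeroʳ c)

-- e, e₂, y, x, F stand for the tallies nA, nB, nAB, nBA, nBoth.
module _ (e e₂ y x F : ℕ) where
  private
    S Pa Pb D : ℕ
    S  = y + (x + F)
    Pa = e + S
    Pb = e₂ + S
    D  = e₂ + F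

    term : ℕ → ℕ → ℕ → ℕ → ℕ
    term p q r k = ((q + r ∸ p) C (q ∸ k)) * (δ (q + r) Pa * placements k (p ∸ k) x y D)

    term-vanishes : ∀ p q r k → placements k (p ∸ k) x y D ≡ 0 → term p q r k ≡ 0
    term-vanishes p q r k W≡0 =
      trans (cong (λ w → ((q + r ∸ p) C (q ∸ k)) * (δ (q + r) Pa * w)) W≡0)
            (c*[d*0]≡0 ((q + r ∸ p) C (q ∸ k)) (δ (q + r) Pa))

    exchange-rhs : ∀ a r → x + a + r ≡ Pa → placements r (x + a) y x (e + F) ≡ (e + F) C a
    exchange-rhs a r x+a+r≡Pa = trans (placements-shift-x x a r y (e + F)) (by-r (belowOrShift y r))
      where
      a+r≡e+F+y : a + r ≡ e + F + y
      a+r≡e+F+y = +-cancelˡ-≡ x (a + r) (e + F + y)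
        (trans (sym (+-assoc x a r)) (trans x+a+r≡Pa (regroup e y x F)))
        where
        regroup : ∀ e y x F → e + (y + (x + F)) ≡ x + (e + F + y)
        regroup = solve-∀
      by-r : BelowOrShift y r → placements r a y 0 (e + F) ≡ (e + F) C a
      by-r (below r<y) = trans (placements-below-y a 0 (e + F) r<y) (sym (k>n⇒nCk≡0 e+F<a))
        where
        e+F<a : e + F < a
        e+F<a = ≰⇒> λ a≤e+F → <⇒≢ (+-mono-≤-< a≤e+F r<y) a+r≡e+F+y
      by-r (shifted b) = begin
        placements (y + b) a y 0 (e + F)   ≡⟨ placements-shift-y y b a 0 (e + F) ⟩
        placements b a 0 0 (e + F)         ≡⟨ placements-free b a (e + F) ⟩
        δ (b + a) (e + F) * ((b + a) C a)  ≡⟨ cong (λ n → δ n (e + F) * (n C a)) b+a≡e+F ⟩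
        δ (e + F) (e + F) * ((e + F) C a)  ≡⟨ cong (_* ((e + F) C a)) (δ-refl (e + F)) ⟩
        1 * ((e + F) C a)                  ≡⟨ *-identityˡ _ ⟩
        (e + F) C a                        ∎
        where
        open ≡-Reasoning
        b+a≡e+F : b + a ≡ e + F
        b+a≡e+F = +-cancelʳ-≡ y (b + a) (e + F)
          (trans (regroup a y b) a+r≡e+F+y)
          where
          regroup : ∀ a y b → b + a + y ≡ a + (y + b)
          regroup = solve-∀

    Pb≡x+[D+y] : Pb ≡ x + (D + y)
    Pb≡x+[D+y] = regroup e₂ y x F
      where
      regroup : ∀ e₂ y x F → e₂ + (y + (x + F)) ≡ x + (e₂ + F + y)
      regroup = solve-∀

    term-shift : ∀ a r j → x + a + r ≡ Pa → term Pb (x + a) r (x + j) ≡ ((x + a + r ∸ Pb) C (a ∸ j)) * (D C j)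
    term-shift a r j x+a+r≡Pa = begin
      (E C (x + a ∸ (x + j))) * (δ (x + a + r) Pa * placements (x + j) (Pb ∸ (x + j)) x y D)
        ≡⟨ cong₂ (λ u w → (E C u) * (δ (x + a + r) Pa * w))
                 ([m+n]∸[m+o]≡n∸o x a j) (placements-shift-y x j (Pb ∸ (x + j)) y D) ⟩
      (E C (a ∸ j)) * (δ (x + a + r) Pa * placements j (Pb ∸ (x + j)) 0 y D)
        ≡⟨ cong₂ (λ u k₃ → (E C (a ∸ j)) * (δ u Pa * placements j k₃ 0 y D)) x+a+r≡Pa
                 (trans (cong (_∸ (x + j)) Pb≡x+[D+y]) ([m+n]∸[m+o]≡n∸o x (D + y) j)) ⟩
      (E C (a ∸ j)) * (δ Pa Pa * placements j ((D + y) ∸ j) 0 y D)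
        ≡⟨ cong₂ (λ u w → (E C (a ∸ j)) * (u * w)) (δ-refl Pa) (placements-binomial D y j) ⟩
      (E C (a ∸ j)) * (1 * (D C j))
        ≡⟨ cong ((E C (a ∸ j)) *_) (*-identityˡ (D C j)) ⟩
      (E C (a ∸ j)) * (D C j) ∎
      where
      open ≡-Reasoning
      E = x + a + r ∸ Pb

    excess+D : ∀ a r → Pb ≤ r → x + a + r ≡ Pa → (x + a + r ∸ Pb) + D ≡ e + F
    excess+D a r Pb≤r x+a+r≡Pa = begin
      (x + a + r ∸ Pb) + D      ≡⟨ cong (λ n → (n ∸ Pb) + D) x+a+r≡Pa ⟩
      (e + S ∸ (e₂ + S)) + D    ≡⟨ cong (_+ D) (trans (cong₂ _∸_ (+-comm e S) (+-comm e₂ S)) ([m+n]∸[m+o]≡n∸o S e e₂)) ⟩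
      (e ∸ e₂) + (e₂ + F)       ≡⟨ +-assoc (e ∸ e₂) e₂ F ⟨
      (e ∸ e₂) + e₂ + F         ≡⟨ cong (_+ F) (m∸n+n≡m e₂≤e) ⟩
      e + F                     ∎
      where
      open ≡-Reasoning
      e₂≤e : e₂ ≤ e
      e₂≤e = +-cancelʳ-≤ S e₂ e (≤-trans Pb≤r (≤-trans (m≤n+m r (x + a)) (≤-reflexive x+a+r≡Pa)))

    -- Terms with k < x vanish, and shifting k = x + j turns the rest into Vandermonde's convolution.
    exchange-lhs : ∀ a r → Pb ≤ r → x + a + r ≡ Pa →
                   sumBelow (suc (Pb ⊓ (x + a))) (term Pb (x + a) r) ≡ (e + F) C a
    exchange-lhs a r Pb≤r x+a+r≡Pa = begin
      sumBelow (suc m) g                      ≡⟨ cong (λ n → sumBelow n g) 1+m≡x+N ⟩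
      sumBelow (x + N) g                      ≡⟨ sumBelow-+ x N g ⟩
      sumBelow x g + sumBelow N (g ∘ (x +_))  ≡⟨ cong₂ _+_ (sumBelow-zero x g-below-x)
                                                            (sumBelow-cong N (λ j _ → term-shift a r j x+a+r≡Pa)) ⟩
      sumBelow N h                            ≡⟨ sumBelow-pad h (s≤s m∸x≤a) h-tail ⟩
      sumBelow (suc a) h                      ≡⟨ vandermonde E D a ⟩
      (E + D) C a                             ≡⟨ cong (_C a) (excess+D a r Pb≤r x+a+r≡Pa) ⟩
      (e + F) C a                             ∎
      where
      open ≡-Reasoning
      q m E N : ℕ
      q = x + a
      m = Pb ⊓ q
      E = q + r ∸ Pb
      N = suc (m ∸ x)
      g h : ℕ → ℕ
      g = term Pb q r
      h j = (E C (a ∸ j)) * (D C j)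

      x≤m : x ≤ m
      x≤m = ⊓-glb (≤-trans (m≤m+n x (D + y)) (≤-reflexive (sym Pb≡x+[D+y]))) (m≤m+n x a)

      1+m≡x+N : suc m ≡ x + N
      1+m≡x+N = sym (trans (+-suc x (m ∸ x)) (cong suc (m+[n∸m]≡n x≤m)))

      m∸x≤a : m ∸ x ≤ a
      m∸x≤a = subst (m ∸ x ≤_) (m+n∸m≡n x a) (∸-monoˡ-≤ x (m⊓n≤n Pb q))

      g-below-x : ∀ k → k < x → g k ≡ 0
      g-below-x k k<x = term-vanishes Pb q r k (placements-below-y (Pb ∸ k) y D k<x)

      h-tail : ∀ j → N ≤ j → j < suc a → h j ≡ 0
      h-tail j N≤j (s≤s j≤a) with ≤-total Pb q
      ... | inj₂ q≤Pb = contradiction (≤-trans N≤j j≤a) (<⇒≱ (s≤s (≤-reflexive (sym m∸x≡a))))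
        where
        m∸x≡a : m ∸ x ≡ a
        m∸x≡a = trans (cong (_∸ x) (m≥n⇒m⊓n≡n q≤Pb)) (m+n∸m≡n x a)
      ... | inj₁ Pb≤q = trans (cong ((E C (a ∸ j)) *_) (k>n⇒nCk≡0 D<j)) (*-zeroʳ (E C (a ∸ j)))
        where
        m∸x≡D+y : m ∸ x ≡ D + y
        m∸x≡D+y = trans (cong (_∸ x) (trans (m≤n⇒m⊓n≡m Pb≤q) Pb≡x+[D+y])) (m+n∸m≡n x (D + y))
        D<j : D < j
        D<j = ≤-trans (s≤s (≤-trans (m≤m+n D y) (≤-reflexive (sym m∸x≡D+y)))) N≤j

  binomial-exchange : ∀ p q r → p ≤ r →
             sumBelow (suc (p ⊓ q)) (term p q r) ≡ δ p Pb * placements r q y x (e + F)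
  binomial-exchange p q r p≤r with p ≟ Pb
  ... | no p≢Pb = trans (sumBelow-zero (suc (p ⊓ q)) vanish) (cong (_* placements r q y x (e + F)) (sym (δ-≢ p≢Pb)))
    where
    vanish : ∀ k → k < suc (p ⊓ q) → term p q r k ≡ 0
    vanish k (s≤s k≤p⊓q) with placements k (p ∸ k) x y D ≟ 0
    ... | yes W≡0 = term-vanishes p q r k W≡0
    ... | no  W≢0 = contradiction p≡Pb p≢Pb
      where
      regroup : ∀ x y e₂ F → x + y + (e₂ + F) ≡ e₂ + (y + (x + F))
      regroup = solve-∀
      p≡Pb : p ≡ Pb
      p≡Pb = trans (sym (m+[n∸m]≡n (≤-trans k≤p⊓q (m⊓n≤m p q))))
                   (trans (placements-support k (p ∸ k) x y D W≢0) (regroup x y e₂ F))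
  ... | yes refl with q + r ≟ Pa
  ...   | no q+r≢Pa = trans (sumBelow-zero (suc (Pb ⊓ q)) vanish)
                            (sym (trans (cong (_* placements r q y x (e + F)) (δ-refl Pb)) (trans (*-identityˡ _) W≡0)))
    where
    vanish : ∀ k → k < suc (Pb ⊓ q) → term Pb q r k ≡ 0
    vanish k _ = trans (cong (λ d → ((q + r ∸ Pb) C (q ∸ k)) * (d * placements k (Pb ∸ k) x y D)) (δ-≢ q+r≢Pa))
                       (*-zeroʳ ((q + r ∸ Pb) C (q ∸ k)))
    W≡0 : placements r q y x (e + F) ≡ 0
    W≡0 with placements r q y x (e + F) ≟ 0
    ... | yes W≡0 = W≡0
    ... | no  W≢0 = contradiction (trans (+-comm q r) (trans (placements-support r q y x (e + F) W≢0) (regroup y x e F))) q+r≢Pa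
      where
      regroup : ∀ y x e F → y + x + (e + F) ≡ e + (y + (x + F))
      regroup = solve-∀
  ...   | yes x+a+r≡Pa with belowOrShift x q
  ...     | below q<x = trans (sumBelow-zero (suc (Pb ⊓ q)) vanish)
                              (sym (trans (cong (δ Pb Pb *_) (placements-below-x r y (e + F) q<x)) (*-zeroʳ (δ Pb Pb))))
    where
    vanish : ∀ k → k < suc (Pb ⊓ q) → term Pb q r k ≡ 0
    vanish k (s≤s k≤Pb⊓q) = term-vanishes Pb q r k
      (placements-below-y (Pb ∸ k) y D (≤-<-trans (≤-trans k≤Pb⊓q (m⊓n≤n Pb q)) q<x))
  ...     | shifted a = trans (exchange-lhs a r p≤r x+a+r≡Pa)
                              (sym (trans (cong (_* placements r (x + a) y x (e + F)) (δ-refl Pb))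
                                   (trans (*-identityˡ _) (exchange-rhs a r x+a+r≡Pa))))

closedForm-exchange : ∀ T p q r → p ≤ r →
  sumBelow (suc (p ⊓ q)) (λ k → ((q + r ∸ p) C (q ∸ k)) * closedForm (swapTally T) k (q + r) (p ∸ k))
  ≡ closedForm T r p q
closedForm-exchange T p q r p≤r = begin
  sumBelow (suc (p ⊓ q)) (λ k → c k * (live T * (δ (q + r) (usesB (swapTally T)) * W k)))
    ≡⟨ sumBelow-cong (suc (p ⊓ q)) (λ k _ → trans (*-left-comm (c k) (live T) _)
         (cong (λ u → live T * (c k * (δ (q + r) u * W k))) (swap-middle (nA T) (nBA T) (nAB T) (nBoth T)))) ⟩
  sumBelow (suc (p ⊓ q)) (λ k → live T * (c k * (δ (q + r) (nA T + (nAB T + (nBA T + nBoth T))) * W k)))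
    ≡⟨ sumBelow-*ˡ (suc (p ⊓ q)) (live T) (λ k → c k * (δ (q + r) (nA T + (nAB T + (nBA T + nBoth T))) * W k)) ⟩
  live T * sumBelow (suc (p ⊓ q)) (λ k → c k * (δ (q + r) (nA T + (nAB T + (nBA T + nBoth T))) * W k))
    ≡⟨ cong (live T *_) (binomial-exchange (nA T) (nB T) (nAB T) (nBA T) (nBoth T) p q r p≤r) ⟩
  closedForm T r p q ∎
  where
  open ≡-Reasoning
  c W : ℕ → ℕ
  c k = (q + r ∸ p) C (q ∸ k)
  W k = placements k (p ∸ k) (nBA T) (nAB T) (nB T + nBoth T)
  swap-middle : ∀ a b c d → a + (b + (c + d)) ≡ a + (c + (b + d))
  swap-middle = solve-∀

-- Growing order ideals

filterᵇ-atMostOne : ∀ {A : Set} (p : A → Bool) xs → Unique xs → (∀ z z′ → T (p z) → T (p z′) → z ≡ z′) →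
                    filterᵇ p xs ≡ [] ⊎ ∃ λ x → filterᵇ p xs ≡ [ x ]
filterᵇ-atMostOne p []       _            p-unique = inj₁ refl
filterᵇ-atMostOne p (x ∷ xs) (x∉xs ∷ !xs) p-unique with p x in px
... | false = filterᵇ-atMostOne p xs !xs p-unique
... | true  = inj₂ (x , cong (x ∷_) (filter-none (T? ∘ p) (ListAll.tabulate λ x′∈xs px′ →
                ListAll.lookup x∉xs x′∈xs (p-unique x _ (Equivalence.from T-≡ px) px′))))

T-allᵇ : ∀ {A : Set} (p : A → Bool) xs → T (allᵇ p xs) → ∀ {z} → z ∈ xs → T (p z)
T-allᵇ p (x ∷ xs) all-p (here refl) = proj₁ (Equivalence.to T-∧ all-p)
T-allᵇ p (x ∷ xs) all-p (there z∈xs) = T-allᵇ p xs (proj₂ (Equivalence.to (T-∧ {p x}) all-p)) z∈xs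

module _ {n : ℕ} where

  x∈p∪⁅x⁆ : ∀ (p : Subset n) x → x ∈ˢ p ∪ ⁅ x ⁆
  x∈p∪⁅x⁆ p x = x∈p∪q⁺ (inj₂ (x∈⁅x⁆ x))

  x∈p⇒x∈p∪⁅y⁆ : ∀ {p : Subset n} {x} y → x ∈ˢ p → x ∈ˢ p ∪ ⁅ y ⁆
  x∈p⇒x∈p∪⁅y⁆ y x∈p = x∈p∪q⁺ (inj₁ x∈p)

  x∈p∪⁅y⁆⁻ : ∀ {p : Subset n} {x y} → x ∈ˢ p ∪ ⁅ y ⁆ → x ∈ˢ p ⊎ x ≡ y
  x∈p∪⁅y⁆⁻ {p} {x} {y} x∈ with x∈p∪q⁻ p ⁅ y ⁆ x∈
  ... | inj₁ x∈p   = inj₁ x∈p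
  ... | inj₂ x∈⁅y⁆ = inj₂ (x∈⁅y⁆⇒x≡y y x∈⁅y⁆)

  x∉p∪⁅y⁆ : ∀ {p : Subset n} {x y} → x ∉ˢ p → x ≢ y → x ∉ˢ p ∪ ⁅ y ⁆
  x∉p∪⁅y⁆ x∉p x≢y x∈ with x∈p∪⁅y⁆⁻ x∈
  ... | inj₁ x∈p = x∉p x∈p
  ... | inj₂ x≡y = x≢y x≡y

module IdealGrowth {n g : ℕ} (Γ : SimpleGraph g) (P : FinPoset n) (κ : Fin n → Fin g)
                   (ec : EC Γ P κ) (na : NA Γ P κ) (ice : ICE2 Γ P κ) where

  MinOut : Fin g → Subset n → Fin n → Set
  MinOut a I x = x ∉ˢ I × κ x ≡ a × (∀ y → _<P_ P y x → y ∈ˢ I)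

  private
    Xi : Fin g → Subset n → List (Subset n)
    Xi = Xideal Γ P κ

    <P⇒ltᵇ : ∀ {y x} → _<P_ P y x → T (ltᵇ P y x)
    <P⇒ltᵇ {y} {x} (y≤x , y≢x) with y Fin.≟ x
    ... | yes y≡x = contradiction y≡x y≢x
    ... | no  _   = Equivalence.from T-∧ (Equivalence.from T-≡ y≤x , _)

    ltᵇ⇒<P : ∀ {y x} → T (ltᵇ P y x) → _<P_ P y x
    ltᵇ⇒<P {y} {x} lt with Equivalence.to (T-∧ {FinPoset.le P y x}) lt
    ... | y≤x , y≢x = Equivalence.to T-≡ y≤x , toWitnessFalse y≢x
      where open import Relation.Nullary.Decidable using (toWitnessFalse)

    T-implies : ∀ {b c} → T b → T (not (b ∧ not c)) → c ≡ true
    T-implies {true} {true} _ _ = refl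

  isMinOutᵇ-sound : ∀ a I x → T (isMinOutᵇ Γ P κ I a x) → MinOut a I x
  isMinOutᵇ-sound a I x isMin with Equivalence.to (T-∧ {not (Vec.lookup I x)}) isMin
  ... | x∉I , rest with Equivalence.to (T-∧ {⌊ κ x Fin.≟ a ⌋}) rest
  ...   | κx≡a , lower = (λ x∈I → subst (T ∘ not) ([]=⇒lookup x∈I) x∉I) , toWitness κx≡a ,
                         λ y y<x → lookup⇒[]= y I (T-implies (<P⇒ltᵇ y<x) (T-allᵇ _ (allFin n) lower (∈-allFin y)))

  MinOut-unique : ∀ {a I x x′} → MinOut a I x → MinOut a I x′ → x ≡ x′
  MinOut-unique {x = x} {x′} (x∉I , κx≡a , lower) (x′∉I , κx′≡a , lower′) with x Fin.≟ x′
  ... | yes x≡x′ = x≡x′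
  ... | no  x≢x′ with ec x x′ (trans κx≡a (sym κx′≡a))
  ...   | inj₁ x≤x′ = contradiction (lower′ x (x≤x′ , x≢x′)) x∉I
  ...   | inj₂ x′≤x = contradiction (lower x′ (x′≤x , x≢x′ ∘ sym)) x′∉I

  data Growth (a : Fin g) (I : Subset n) : Set where
    stuck : Xi a I ≡ [] → Growth a I
    grows : ∀ x → MinOut a I x → Xi a I ≡ [ I ∪ ⁅ x ⁆ ] → Growth a I

  growth : ∀ a I → Growth a I
  growth a I with filterᵇ-atMostOne (isMinOutᵇ Γ P κ I a) (allFin n) (allFin⁺ n)
                    (λ z z′ mz mz′ → MinOut-unique (isMinOutᵇ-sound a I z mz) (isMinOutᵇ-sound a I z′ mz′))
  ... | inj₁ none       = stuck (cong (map (λ x → I ∪ ⁅ x ⁆)) none)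
  ... | inj₂ (x , single) = grows x (isMinOutᵇ-sound a I x x-min) (cong (map (λ x → I ∪ ⁅ x ⁆)) single)
    where
    x-min : T (isMinOutᵇ Γ P κ I a x)
    x-min = proj₂ (∈-filter⁻ (T? ∘ isMinOutᵇ Γ P κ I a) {xs = allFin n} (subst (x ∈_) (sym single) (here refl)))

  ∈-Xideal⁻ : ∀ {a I s} → s ∈ Xi a I → ∃ λ x → MinOut a I x × s ≡ I ∪ ⁅ x ⁆
  ∈-Xideal⁻ {a} {I} s∈ with growth a I
  ... | stuck none = case subst (_ ∈_) none s∈ of λ ()
  ... | grows x x-min single with subst (_ ∈_) single s∈
  ...   | here s≡ = x , x-min , s≡

  Xideal-empty : ∀ {a I} → (∀ x → ¬ MinOut a I x) → Xi a I ≡ []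
  Xideal-empty {a} {I} noMin = cong (map (λ x → I ∪ ⁅ x ⁆))
    (filter-none (T? ∘ isMinOutᵇ Γ P κ I a) {xs = allFin n}
                 (ListAll.tabulate λ {z} _ z-min → noMin z (isMinOutᵇ-sound a I z z-min)))

  MinOut-ideal : ∀ {a I x} → IsIdeal P I → MinOut a I x → IsIdeal P (I ∪ ⁅ x ⁆)
  MinOut-ideal {I = I} {x} I-ideal (_ , _ , lower) z y y≤z z∈ with x∈p∪q⁻ I ⁅ x ⁆ z∈
  ... | inj₁ z∈I = x∈p∪q⁺ (inj₁ (I-ideal z y y≤z z∈I))
  ... | inj₂ z∈⁅x⁆ with x∈⁅y⁆⇒x≡y x z∈⁅x⁆
  ...   | refl with y Fin.≟ z
  ...     | yes refl = x∈p∪q⁺ (inj₂ (x∈⁅x⁆ y))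
  ...     | no  y≢z  = x∈p∪q⁺ (inj₁ (lower y (y≤z , y≢z)))

  -- The next element of colour a above x would cover x, against NA since a ≁ a.
  MinOut-saturates : ∀ {a I x} → IsIdeal P I → MinOut a I x → Xi a (I ∪ ⁅ x ⁆) ≡ []
  MinOut-saturates {a} {I} {x} I-ideal (x∉I , κx≡a , lower) = Xideal-empty no-next
    where
    no-next : ∀ z → ¬ MinOut a (I ∪ ⁅ x ⁆) z
    no-next z (z∉J , κz≡a , lower-z) with z Fin.≟ x
    ... | yes refl = z∉J (x∈p∪⁅x⁆ I z)
    ... | no  z≢x with ec x z (trans κx≡a (sym κz≡a))
    ...   | inj₂ z≤x = z∉J (x∈p⇒x∈p∪⁅y⁆ x (lower z (z≤x , z≢x)))
    ...   | inj₁ x≤z = case trans (sym (subst₂ (λ u v → SimpleGraph.adj Γ u v ≡ true) κx≡a κz≡a (na x z covers)))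
                                  (SimpleGraph.irrefl Γ a) of λ ()
      where
      covers : Covers P x z
      covers = (x≤z , z≢x ∘ sym) , λ { (w , (x≤w , x≢w) , w<z) → case x∈p∪⁅y⁆⁻ (lower-z w w<z) of λ
                 { (inj₁ w∈I) → x∉I (I-ideal w x x≤w w∈I)
                 ; (inj₂ w≡x) → x≢w (sym w≡x) } }

  -- Between x and the next element y of colour a only x′ can lie, while ICE2 demands two
  -- elements there with colours adjacent to a.
  MinOut-MinOut-saturates : ∀ {a b I x x′} → a ≢ b → IsIdeal P I → MinOut a I x → MinOut b (I ∪ ⁅ x ⁆) x′ →
                            Xi a ((I ∪ ⁅ x ⁆) ∪ ⁅ x′ ⁆) ≡ []
  MinOut-MinOut-saturates {a} {b} {I} {x} {x′} a≢b I-ideal (x∉I , κx≡a , lower) (_ , κx′≡b , _) =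
    Xideal-empty no-next
    where
    no-next : ∀ y → ¬ MinOut a ((I ∪ ⁅ x ⁆) ∪ ⁅ x′ ⁆) y
    no-next y (y∉K , κy≡a , lower-y) with y Fin.≟ x
    ... | yes refl = y∉K (x∈p⇒x∈p∪⁅y⁆ x′ (x∈p∪⁅x⁆ I y))
    ... | no  y≢x with ec x y (trans κx≡a (sym κy≡a))
    ...   | inj₂ y≤x = y∉K (x∈p⇒x∈p∪⁅y⁆ x′ (x∈p⇒x∈p∪⁅y⁆ x (lower y (y≤x , y≢x))))
    ...   | inj₁ x≤y = at-most-one (filterᵇ-atMostOne p (allFin n) (allFin⁺ n)
                         (λ z z′ pz pz′ → trans (p⇒x′ z pz) (sym (p⇒x′ z′ pz′))))
      where
      between : ∀ z → _<P_ P x z → _<P_ P z y → z ≡ x′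
      between z (x≤z , x≢z) z<y with x∈p∪⁅y⁆⁻ (lower-y z z<y)
      ... | inj₂ z≡x′ = z≡x′
      ... | inj₁ z∈J with x∈p∪⁅y⁆⁻ z∈J
      ...   | inj₁ z∈I = contradiction (I-ideal z x x≤z z∈I) x∉I
      ...   | inj₂ z≡x = contradiction (sym z≡x) x≢z

      p : Fin n → Bool
      p z = ltᵇ P x z ∧ ltᵇ P z y ∧ SimpleGraph.adj Γ (κ z) a

      p⇒x′ : ∀ z → T (p z) → z ≡ x′
      p⇒x′ z pz with Equivalence.to (T-∧ {ltᵇ P x z}) pz
      ... | x<z , rest = between z (ltᵇ⇒<P x<z) (ltᵇ⇒<P (proj₁ (Equivalence.to (T-∧ {ltᵇ P z y}) rest)))

      no-a-between : ∀ z → _<P_ P x z → _<P_ P z y → κ z ≢ a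
      no-a-between z x<z z<y κz≡a = a≢b (trans (sym κz≡a) (trans (cong κ (between z x<z z<y)) κx′≡b))

      two : countP P p ≡ 2
      two = ice a x y κx≡a κy≡a (x≤y , y≢x ∘ sym) no-a-between

      at-most-one : filterᵇ p (allFin n) ≡ [] ⊎ ∃ (λ w → filterᵇ p (allFin n) ≡ [ w ]) → ⊥
      at-most-one (inj₁ none)       = case trans (sym (cong length none)) two of λ ()
      at-most-one (inj₂ (_ , single)) = case trans (sym (cong length single)) two of λ ()

  ∈-Xideal-ideal : ∀ {a I s} → IsIdeal P I → s ∈ Xi a I → IsIdeal P s
  ∈-Xideal-ideal I-ideal s∈ with ∈-Xideal⁻ s∈
  ... | x , x-min , refl = MinOut-ideal I-ideal x-min

  ∈-Xideal-saturated : ∀ {a I s} → IsIdeal P I → s ∈ Xi a I → Xi a s ≡ []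
  ∈-Xideal-saturated I-ideal s∈ with ∈-Xideal⁻ s∈
  ... | x , x-min , refl = MinOut-saturates I-ideal x-min

  ∈-Xideal-saturated₂ : ∀ {a b I s s′} → a ≢ b → IsIdeal P I → s ∈ Xi a I → s′ ∈ Xi b s → Xi a s′ ≡ []
  ∈-Xideal-saturated₂ a≢b I-ideal s∈ s′∈ with ∈-Xideal⁻ s∈
  ... | x , x-min , refl with ∈-Xideal⁻ s′∈
  ...   | x′ , x′-min , refl = MinOut-MinOut-saturates a≢b I-ideal x-min x′-min

module _ {A B : Set} where

  concatMap⁺ : ∀ (f : A → List B) {xs ys} → xs ↭ ys → concatMap f xs ↭ concatMap f ys
  concatMap⁺ f ↭.refl                = ↭-refl
  concatMap⁺ f (prep x xs↭ys)        = ++⁺ˡ (f x) (concatMap⁺ f xs↭ys)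
  concatMap⁺ f (swap x y xs↭ys)      = ↭-trans (shifts (f x) (f y)) (++⁺ˡ (f y) (++⁺ˡ (f x) (concatMap⁺ f xs↭ys)))
  concatMap⁺ f (↭.trans xs↭ys ys↭zs) = ↭-trans (concatMap⁺ f xs↭ys) (concatMap⁺ f ys↭zs)

  concatMap-++-↭ : ∀ (f h : A → List B) xs → concatMap (λ x → f x ++ h x) xs ↭ concatMap f xs ++ concatMap h xs
  concatMap-++-↭ f h []       = ↭-refl
  concatMap-++-↭ f h (x ∷ xs) = ↭-trans (↭-reflexive (++-assoc (f x) (h x) _))
    (↭-trans (++⁺ˡ (f x) (↭-trans (++⁺ˡ (h x) (concatMap-++-↭ f h xs)) (shifts (h x) (concatMap f xs))))
             (↭-reflexive (sym (++-assoc (f x) (concatMap f xs) _))))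

  concatMap-cong-∈ : ∀ {f h : A → List B} xs → (∀ {x} → x ∈ xs → f x ≡ h x) → concatMap f xs ≡ concatMap h xs
  concatMap-cong-∈ xs f≡h = cong concat (map-cong-local (ListAll.tabulate f≡h))

  concatMap-replicate : ∀ (f : A → List B) k xs → concatMap f (concat (replicate k xs)) ≡ concat (replicate k (concatMap f xs))
  concatMap-replicate f zero    xs = refl
  concatMap-replicate f (suc k) xs = trans (concatMap-++ f xs _) (cong (concatMap f xs ++_) (concatMap-replicate f k xs))

concatMap-concatMap : ∀ {A B C : Set} (f : B → List C) (g : A → List B) xs →
                      concatMap f (concatMap g xs) ≡ concatMap (concatMap f ∘ g) xs
concatMap-concatMap f g []       = refl
concatMap-concatMap f g (x ∷ xs) = trans (concatMap-++ f (g x) _) (cong (concatMap f (g x) ++_) (concatMap-concatMap f g xs))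

concatMap-[] : ∀ {A B : Set} (xs : List A) → concatMap {B = B} (λ _ → []) xs ≡ []
concatMap-[] []       = refl
concatMap-[] (_ ∷ xs) = concatMap-[] xs

concatMap-transpose : ∀ {A B C : Set} (h : A → B → C) (S : List A) (R : List B) →
                      concatMap (λ v → map (λ s → h s v) S) R ↭ concatMap (λ s → map (h s) R) S
concatMap-transpose h []      R = ↭-reflexive (concatMap-[] R)
concatMap-transpose h (s ∷ S) R = ↭-trans (concatMap-++-↭ (λ v → [ h s v ]) (λ v → map (λ s → h s v) S) R)
  (++⁺ (↭-reflexive (trans (sym (concatMap-map [_] (h s) R)) (concatMap-pure (map (h s) R))))
       (concatMap-transpose h S R))

module _ {A : Set} where

  sum-map-cong-∈ : ∀ {f h : A → ℕ} xs → (∀ {x} → x ∈ xs → f x ≡ h x) → sum (map f xs) ≡ sum (map h xs)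
  sum-map-cong-∈ xs f≡h = cong sum (map-cong-local (ListAll.tabulate f≡h))

  sum-map-zero : ∀ {f : A → ℕ} xs → (∀ {x} → x ∈ xs → f x ≡ 0) → sum (map f xs) ≡ 0
  sum-map-zero []       f≡0 = refl
  sum-map-zero (x ∷ xs) f≡0 = cong₂ _+_ (f≡0 (here refl)) (sum-map-zero xs (f≡0 ∘ there))

  sum-map-+ : ∀ (f h : A → ℕ) xs → sum (map (λ x → f x + h x) xs) ≡ sum (map f xs) + sum (map h xs)
  sum-map-+ f h []       = refl
  sum-map-+ f h (x ∷ xs) = trans (cong (f x + h x +_) (sum-map-+ f h xs)) (+-+-interchange (f x) (h x) _ _)

  sum-map-*ˡ : ∀ c (f : A → ℕ) xs → sum (map (λ x → c * f x) xs) ≡ c * sum (map f xs)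
  sum-map-*ˡ c f []       = sym (*-zeroʳ c)
  sum-map-*ˡ c f (x ∷ xs) = trans (cong (c * f x +_) (sum-map-*ˡ c f xs)) (sym (*-distribˡ-+ c (f x) _))

  sum-map-*ʳ : ∀ c (f : A → ℕ) xs → sum (map (λ x → f x * c) xs) ≡ sum (map f xs) * c
  sum-map-*ʳ c f []       = refl
  sum-map-*ʳ c f (x ∷ xs) = trans (cong (f x * c +_) (sum-map-*ʳ c f xs)) (sym (*-distribʳ-+ c (f x) _))

indicator : Bool → ℕ
indicator false = 0
indicator true  = 1

module _ {n : ℕ} where

  _≟ˢ_ : (s u : Subset n) → Dec (s ≡ u)
  _≟ˢ_ = Vec.≡-dec Bool._≟_

  same : Subset n → Subset n → ℕ
  same s u = indicator ⌊ s ≟ˢ u ⌋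

  count : ∀ {m} → Vec (Subset n) m → List (Vec (Subset n) m) → ℕ
  count u L = length (filterᵇ (_≟T u) L)

  count-++ : ∀ {m} (u : Vec (Subset n) m) xs ys → count u (xs ++ ys) ≡ count u xs + count u ys
  count-++ u xs ys = trans (cong length (filter-++ (T? ∘ (_≟T u)) xs ys)) (length-++ (filterᵇ (_≟T u) xs))

  count-↭ : ∀ {m} (u : Vec (Subset n) m) {xs ys} → xs ↭ ys → count u xs ≡ count u ys
  count-↭ u xs↭ys = ↭-length (filter-↭ (T? ∘ (_≟T u)) xs↭ys)

  count-replicate : ∀ {m} (u : Vec (Subset n) m) k L → count u (concat (replicate k L)) ≡ k * count u L
  count-replicate u zero    L = refl
  count-replicate u (suc k) L = trans (count-++ u L _) (cong (count u L +_) (count-replicate u k L))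

  count-concatMap : ∀ {m} {C : Set} (u : Vec (Subset n) m) (f : C → List (Vec (Subset n) m)) xs →
                    count u (concatMap f xs) ≡ sum (map (count u ∘ f) xs)
  count-concatMap u f []       = refl
  count-concatMap u f (x ∷ xs) = trans (count-++ u (f x) _) (cong (count u (f x) +_) (count-concatMap u f xs))

  count-∷ : ∀ {m} (u : Vec (Subset n) m) v L → count u (v ∷ L) ≡ indicator (v ≟T u) + count u L
  count-∷ u v L with v ≟T u
  ... | true  = refl
  ... | false = refl

  ≟T-∷ : ∀ {m} s u₀ (v u : Vec (Subset n) m) → (s ∷ v) ≟T (u₀ ∷ u) ≡ ⌊ s ≟ˢ u₀ ⌋ ∧ (v ≟T u)
  ≟T-∷ s u₀ v u = trans (isYes≗does (_≟ᵛ_ (s ∷ v) (u₀ ∷ u)))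
    (trans (does-⇔ (mk⇔ ∷-injective (uncurry (cong₂ _∷_))) (_≟ᵛ_ (s ∷ v) (u₀ ∷ u)) (s ≟ˢ u₀ ×-dec _≟ᵛ_ v u))
           (sym (cong₂ _∧_ (isYes≗does (s ≟ˢ u₀)) (isYes≗does (_≟ᵛ_ v u)))))
    where
    _≟ᵛ_ : ∀ {k} (x y : Vec (Subset n) k) → Dec (x ≡ y)
    _≟ᵛ_ = Vec.≡-dec _≟ˢ_

  count-map-∷ : ∀ {m} u₀ s (u : Vec (Subset n) m) L → count (u₀ ∷ u) (map (s ∷_) L) ≡ same s u₀ * count u L
  count-map-∷ u₀ s u []      = sym (*-zeroʳ (same s u₀))
  count-map-∷ u₀ s u (v ∷ L) = begin
    count (u₀ ∷ u) (map (s ∷_) (v ∷ L))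
      ≡⟨ count-∷ (u₀ ∷ u) (s ∷ v) (map (s ∷_) L) ⟩
    indicator ((s ∷ v) ≟T (u₀ ∷ u)) + count (u₀ ∷ u) (map (s ∷_) L)
      ≡⟨ cong₂ (λ b c → indicator b + c) (≟T-∷ s u₀ v u) (count-map-∷ u₀ s u L) ⟩
    indicator (⌊ s ≟ˢ u₀ ⌋ ∧ (v ≟T u)) + indicator ⌊ s ≟ˢ u₀ ⌋ * count u L
      ≡⟨ indicator-∧ ⌊ s ≟ˢ u₀ ⌋ (v ≟T u) (count u L) ⟩
    indicator ⌊ s ≟ˢ u₀ ⌋ * (indicator (v ≟T u) + count u L)
      ≡⟨ cong (same s u₀ *_) (count-∷ u v L) ⟨
    same s u₀ * count u (v ∷ L) ∎
    where
    open ≡-Reasoning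
    indicator-∧ : ∀ b c x → indicator (b ∧ c) + indicator b * x ≡ indicator b * (indicator c + x)
    indicator-∧ false c x = refl
    indicator-∧ true  c x = trans (cong (indicator c +_) (+-identityʳ x)) (sym (+-identityʳ _))

record Linear {A : Set} (Φ : List A → List A) : Set where
  field
    resp-↭ : ∀ {xs ys} → xs ↭ ys → Φ xs ↭ Φ ys
    hom-++ : ∀ xs ys → Φ (xs ++ ys) ≡ Φ xs ++ Φ ys
    hom-[] : Φ [] ≡ []

  hom-concatMap : ∀ {C : Set} (f : C → List A) xs → Φ (concatMap f xs) ≡ concatMap (Φ ∘ f) xs
  hom-concatMap f []       = hom-[]
  hom-concatMap f (x ∷ xs) = trans (hom-++ (f x) (concatMap f xs)) (cong (Φ (f x) ++_) (hom-concatMap f xs))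

  hom-replicate : ∀ k xs → Φ (concat (replicate k xs)) ≡ concat (replicate k (Φ xs))
  hom-replicate zero    xs = hom-[]
  hom-replicate (suc k) xs = trans (hom-++ xs _) (cong (Φ xs ++_) (hom-replicate k xs))

open Linear

id-linear : ∀ {A : Set} → Linear {A} (λ xs → xs)
id-linear = record { resp-↭ = λ p → p ; hom-++ = λ _ _ → refl ; hom-[] = refl }

∘-linear : ∀ {A : Set} {Φ Ψ : List A → List A} → Linear Φ → Linear Ψ → Linear (Φ ∘ Ψ)
∘-linear {Φ = Φ} {Ψ} Φ-lin Ψ-lin = record
  { resp-↭ = resp-↭ Φ-lin ∘ resp-↭ Ψ-lin
  ; hom-++ = λ xs ys → trans (cong Φ (hom-++ Ψ-lin xs ys)) (hom-++ Φ-lin (Ψ xs) (Ψ ys))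
  ; hom-[] = trans (cong Φ (hom-[] Ψ-lin)) (hom-[] Φ-lin)
  }

concatMap-linear : ∀ {A : Set} (f : A → List A) → Linear (concatMap f)
concatMap-linear f = record { resp-↭ = concatMap⁺ f ; hom-++ = concatMap-++ f ; hom-[] = refl }

weighted : (e ia ib iab iba : ℕ) → Counts → Counts
weighted e ia ib iab iba N k₁ k₂ k₃ =
  e * N k₁ k₂ k₃
  + ia * (k₁ * N (pred k₁) k₂ k₃ + k₃ * N k₁ k₂ (pred k₃))
  + ib * (k₂ * N k₁ (pred k₂) k₃)
  + iab * (k₁ * (k₂ * N (pred k₁) (pred k₂) k₃))
  + iba * (k₂ * (k₃ * N k₁ (pred k₂) (pred k₃)))

module Tuples {n g : ℕ} (Γ : SimpleGraph g) (P : FinPoset n) (κ : Fin n → Fin g) where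

  private
    Sub : Set
    Sub = Subset n

    Xi : Fin g → Sub → List Sub
    Xi = Xideal Γ P κ

    Xt : ∀ {m} → Fin g → Vec Sub m → List (Vec Sub m)
    Xt = Xtuple Γ P κ

  Xtuple-∷ : ∀ {m} a t₀ (t : Vec Sub m) → Xt a (t₀ ∷ t) ≡ map (_∷ t) (Xi a t₀) ++ map (t₀ ∷_) (Xt a t)
  Xtuple-∷ {m} a t₀ t = cong (map (_∷ t) (Xi a t₀) ++_) (begin
    concatMap f (tabulate Fin.suc)                       ≡⟨ cong (concatMap f) (map-tabulate (λ j → j) Fin.suc) ⟨
    concatMap f (map Fin.suc (allFin m))                 ≡⟨ concatMap-map f Fin.suc (allFin m) ⟩
    concatMap (f ∘ Fin.suc) (allFin m)                   ≡⟨ concatMap-cong (λ j → map-∘ (Xi a (lookup t j))) (allFin m) ⟩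
    concatMap (map (t₀ ∷_) ∘ f′) (allFin m)              ≡⟨ map-concatMap (t₀ ∷_) f′ (allFin m) ⟨
    map (t₀ ∷_) (Xt a t)                                 ∎)
    where
    open ≡-Reasoning
    f : Fin (suc m) → List (Vec Sub (suc m))
    f j = map (λ J → (t₀ ∷ t) [ j ]≔ J) (Xi a (lookup (t₀ ∷ t) j))
    f′ : Fin m → List (Vec Sub m)
    f′ j = map (λ J → t [ j ]≔ J) (Xi a (lookup t j))

  iterX : ∀ {m} → Fin g → ℕ → List (Vec Sub m) → List (Vec Sub m)
  iterX a zero    L = L
  iterX a (suc k) L = concatMap (Xt a) (iterX a k L)

  iterX-linear : ∀ {m} a k → Linear (iterX {m} a k)
  iterX-linear a zero    = id-linear
  iterX-linear a (suc k) = ∘-linear (concatMap-linear (Xt a)) (iterX-linear a k)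

  iterX-[] : ∀ {m} a k → iterX {m} a k [] ≡ []
  iterX-[] a k = hom-[] (iterX-linear a k)

  headGrown : ∀ {m} → Fin g → Sub → List (Vec Sub m) → List (Vec Sub (suc m))
  headGrown a t₀ R = concatMap (λ s → map (s ∷_) R) (Xi a t₀)

  headGrown-Xt : ∀ {m} a t₀ (X : List (Vec Sub m)) → (∀ {s} → s ∈ Xi a t₀ → Xi a s ≡ []) →
                 concatMap (Xt a) (headGrown a t₀ X) ≡ headGrown a t₀ (concatMap (Xt a) X)
  headGrown-Xt a t₀ X saturated = trans (concatMap-concatMap (Xt a) (λ s → map (s ∷_) X) (Xi a t₀))
    (concatMap-cong-∈ (Xi a t₀) λ {s} s∈ → begin
      concatMap (Xt a) (map (s ∷_) X)
        ≡⟨ trans (concatMap-map (Xt a) (s ∷_) X) (concatMap-cong (Xtuple-∷ a s) X) ⟩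
      concatMap (λ v → map (_∷ v) (Xi a s) ++ map (s ∷_) (Xt a v)) X
        ≡⟨ concatMap-cong (λ v → cong (λ L → map (_∷ v) L ++ map (s ∷_) (Xt a v)) (saturated s∈)) X ⟩
      concatMap (map (s ∷_) ∘ Xt a) X                            ≡⟨ map-concatMap (s ∷_) (Xt a) X ⟨
      map (s ∷_) (concatMap (Xt a) X)                            ∎)
    where open ≡-Reasoning

  -- Since X_a X_a t₀ = 0, the head coordinate is acted on at most once among the k factors X_a.
  iterX-∷ : ∀ {m} a k t₀ (R : List (Vec Sub m)) → (∀ {s} → s ∈ Xi a t₀ → Xi a s ≡ []) →
            iterX a k (map (t₀ ∷_) R) ↭ map (t₀ ∷_) (iterX a k R) ++ concat (replicate k (headGrown a t₀ (iterX a (pred k) R)))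
  iterX-∷ a zero    t₀ R saturated = ↭-reflexive (sym (++-identityʳ _))
  iterX-∷ a (suc k) t₀ R saturated = begin
    concatMap (Xt a) (iterX a k (map (t₀ ∷_) R))
      ↭⟨ concatMap⁺ (Xt a) (iterX-∷ a k t₀ R saturated) ⟩
    concatMap (Xt a) (map (t₀ ∷_) Rₖ ++ concat (replicate k (headGrown a t₀ (iterX a (pred k) R))))
      ≡⟨ concatMap-++ (Xt a) (map (t₀ ∷_) Rₖ) _ ⟩
    concatMap (Xt a) (map (t₀ ∷_) Rₖ) ++ concatMap (Xt a) (concat (replicate k (headGrown a t₀ (iterX a (pred k) R))))
      ↭⟨ ++⁺ head-or-tail (↭-reflexive (trans (concatMap-replicate (Xt a) k _) (later k))) ⟩
    (map (t₀ ∷_) (iterX a (suc k) R) ++ headGrown a t₀ Rₖ) ++ concat (replicate k (headGrown a t₀ Rₖ))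
      ≡⟨ ++-assoc (map (t₀ ∷_) (iterX a (suc k) R)) (headGrown a t₀ Rₖ) _ ⟩
    map (t₀ ∷_) (iterX a (suc k) R) ++ concat (replicate (suc k) (headGrown a t₀ Rₖ)) ∎
    where
    open import Data.List.Relation.Binary.Permutation.Propositional using (module PermutationReasoning)
    open PermutationReasoning
    Rₖ = iterX a k R

    head-or-tail : concatMap (Xt a) (map (t₀ ∷_) Rₖ) ↭ map (t₀ ∷_) (iterX a (suc k) R) ++ headGrown a t₀ Rₖ
    head-or-tail = begin
      concatMap (Xt a) (map (t₀ ∷_) Rₖ)
        ≡⟨ trans (concatMap-map (Xt a) (t₀ ∷_) Rₖ) (concatMap-cong (Xtuple-∷ a t₀) Rₖ) ⟩
      concatMap (λ v → map (_∷ v) (Xi a t₀) ++ map (t₀ ∷_) (Xt a v)) Rₖ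
        ↭⟨ concatMap-++-↭ (λ v → map (_∷ v) (Xi a t₀)) (λ v → map (t₀ ∷_) (Xt a v)) Rₖ ⟩
      concatMap (λ v → map (_∷ v) (Xi a t₀)) Rₖ ++ concatMap (map (t₀ ∷_) ∘ Xt a) Rₖ
        ↭⟨ ++-comm (concatMap (λ v → map (_∷ v) (Xi a t₀)) Rₖ) _ ⟩
      concatMap (map (t₀ ∷_) ∘ Xt a) Rₖ ++ concatMap (λ v → map (_∷ v) (Xi a t₀)) Rₖ
        ↭⟨ ++⁺ (↭-reflexive (sym (map-concatMap (t₀ ∷_) (Xt a) Rₖ))) (concatMap-transpose _∷_ (Xi a t₀) Rₖ) ⟩
      map (t₀ ∷_) (iterX a (suc k) R) ++ headGrown a t₀ Rₖ ∎

    later : ∀ k → concat (replicate k (concatMap (Xt a) (headGrown a t₀ (iterX a (pred k) R))))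
                  ≡ concat (replicate k (headGrown a t₀ (iterX a k R)))
    later zero    = refl
    later (suc k) = cong (concat ∘ replicate (suc k)) (headGrown-Xt a t₀ (iterX a k R) saturated)

  reach : Fin g → Sub → Sub → ℕ
  reach a t₀ u₀ = sum (map (λ s → same s u₀) (Xi a t₀))

  reach₂ : Fin g → Fin g → Sub → Sub → ℕ
  reach₂ a b t₀ u₀ = sum (map (λ s → reach b s u₀) (Xi a t₀))

  count-iterX-∷ : ∀ {m} {Φ} → Linear Φ → ∀ a k t₀ (R : List (Vec Sub m)) u → (∀ {s} → s ∈ Xi a t₀ → Xi a s ≡ []) →
    count u (Φ (iterX a k (map (t₀ ∷_) R)))
    ≡ count u (Φ (map (t₀ ∷_) (iterX a k R)))
      + k * sum (map (λ s → count u (Φ (map (s ∷_) (iterX a (pred k) R)))) (Xi a t₀))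
  count-iterX-∷ {Φ = Φ} Φ-linear a k t₀ R u saturated = begin
    count u (Φ (iterX a k (map (t₀ ∷_) R)))
      ≡⟨ count-↭ u (resp-↭ Φ-linear (iterX-∷ a k t₀ R saturated)) ⟩
    count u (Φ (map (t₀ ∷_) (iterX a k R) ++ concat (replicate k G)))
      ≡⟨ trans (cong (count u) (hom-++ Φ-linear (map (t₀ ∷_) (iterX a k R)) (concat (replicate k G))))
               (count-++ u (Φ (map (t₀ ∷_) (iterX a k R))) (Φ (concat (replicate k G)))) ⟩
    count u (Φ (map (t₀ ∷_) (iterX a k R))) + count u (Φ (concat (replicate k G)))
      ≡⟨ cong (count u (Φ (map (t₀ ∷_) (iterX a k R))) +_) (begin
           count u (Φ (concat (replicate k G)))   ≡⟨ cong (count u) (hom-replicate Φ-linear k G) ⟩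
           count u (concat (replicate k (Φ G)))   ≡⟨ count-replicate u k (Φ G) ⟩
           k * count u (Φ G)                      ≡⟨ cong (λ L → k * count u L) (hom-concatMap Φ-linear _ (Xi a t₀)) ⟩
           k * count u (concatMap (λ s → Φ (map (s ∷_) (iterX a (pred k) R))) (Xi a t₀))
             ≡⟨ cong (k *_) (count-concatMap u _ (Xi a t₀)) ⟩
           k * sum (map (λ s → count u (Φ (map (s ∷_) (iterX a (pred k) R)))) (Xi a t₀)) ∎) ⟩
    count u (Φ (map (t₀ ∷_) (iterX a k R)))
      + k * sum (map (λ s → count u (Φ (map (s ∷_) (iterX a (pred k) R)))) (Xi a t₀)) ∎
    where
    open ≡-Reasoning
    G = headGrown a t₀ (iterX a (pred k) R)

  count-a-∷ : ∀ {m} a k s u₀ (Y : List (Vec Sub m)) u → (∀ {s′} → s′ ∈ Xi a s → Xi a s′ ≡ []) →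
    count (u₀ ∷ u) (iterX a k (map (s ∷_) Y))
    ≡ same s u₀ * count u (iterX a k Y) + k * (reach a s u₀ * count u (iterX a (pred k) Y))
  count-a-∷ a k s u₀ Y u saturated = trans (count-iterX-∷ id-linear a k s Y (u₀ ∷ u) saturated)
    (cong₂ (λ x y → x + k * y) (count-map-∷ u₀ s u (iterX a k Y))
      (trans (sum-map-cong-∈ (Xi a s) (λ {s′} _ → count-map-∷ u₀ s′ u (iterX a (pred k) Y)))
             (sum-map-*ʳ (count u (iterX a (pred k) Y)) (λ s′ → same s′ u₀) (Xi a s))))

  count-ba-∷ : ∀ {m} a b k₂ k₃ s u₀ (X : List (Vec Sub m)) u →
    (∀ {s′} → s′ ∈ Xi b s → Xi b s′ ≡ []) → (∀ {s′} → s′ ∈ Xi a s → Xi a s′ ≡ []) →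
    (∀ {s′} → s′ ∈ Xi b s → ∀ {s″} → s″ ∈ Xi a s′ → Xi a s″ ≡ []) →
    count (u₀ ∷ u) (iterX a k₃ (iterX b k₂ (map (s ∷_) X)))
    ≡ same s u₀ * count u (iterX a k₃ (iterX b k₂ X)) + k₃ * (reach a s u₀ * count u (iterX a (pred k₃) (iterX b k₂ X)))
      + k₂ * (reach b s u₀ * count u (iterX a k₃ (iterX b (pred k₂) X))
              + k₃ * (reach₂ b a s u₀ * count u (iterX a (pred k₃) (iterX b (pred k₂) X))))
  count-ba-∷ a b k₂ k₃ s u₀ X u b-saturated a-saturated a-saturated-after-b =
    trans (count-iterX-∷ (iterX-linear a k₃) b k₂ s X (u₀ ∷ u) b-saturated)
      (cong₂ (λ x y → x + k₂ * y) (count-a-∷ a k₃ s u₀ (iterX b k₂ X) u a-saturated) (begin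
        sum (map (λ s′ → count (u₀ ∷ u) (iterX a k₃ (map (s′ ∷_) X′))) (Xi b s))
          ≡⟨ sum-map-cong-∈ (Xi b s) (λ s′∈ → count-a-∷ a k₃ _ u₀ X′ u (a-saturated-after-b s′∈)) ⟩
        sum (map (λ s′ → same s′ u₀ * B + k₃ * (reach a s′ u₀ * B′)) (Xi b s))
          ≡⟨ sum-map-+ (λ s′ → same s′ u₀ * B) (λ s′ → k₃ * (reach a s′ u₀ * B′)) (Xi b s) ⟩
        sum (map (λ s′ → same s′ u₀ * B) (Xi b s)) + sum (map (λ s′ → k₃ * (reach a s′ u₀ * B′)) (Xi b s))
          ≡⟨ cong₂ _+_ (sum-map-*ʳ B (λ s′ → same s′ u₀) (Xi b s))
                       (trans (sum-map-*ˡ k₃ (λ s′ → reach a s′ u₀ * B′) (Xi b s))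
                              (cong (k₃ *_) (sum-map-*ʳ B′ (λ s′ → reach a s′ u₀) (Xi b s)))) ⟩
        reach b s u₀ * B + k₃ * (reach₂ b a s u₀ * B′) ∎))
    where
    open ≡-Reasoning
    X′ = iterX b (pred k₂) X
    B  = count u (iterX a k₃ X′)
    B′ = count u (iterX a (pred k₃) X′)

  paths : ∀ {m} → Fin g → Fin g → ℕ → ℕ → ℕ → Vec Sub m → Vec Sub m → ℕ
  paths a b k₁ k₂ k₃ t u = count u (iterX a k₃ (iterX b k₂ (iterX a k₁ [ t ])))

  module PathCounting
    (Good : Sub → Set)
    (saturates : ∀ {a I s} → Good I → s ∈ Xi a I → Xi a s ≡ [])
    (good-step : ∀ {a I s} → Good I → s ∈ Xi a I → Good s)
    (saturates₂ : ∀ {a b I s s′} → a ≢ b → Good I → s ∈ Xi a I → s′ ∈ Xi b s → Xi a s′ ≡ [])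
    where

    private
      count-ba-good : ∀ {m} a b k₂ k₃ {s} u₀ (X : List (Vec Sub m)) u → Good s →
        count (u₀ ∷ u) (iterX a k₃ (iterX b k₂ (map (s ∷_) X)))
        ≡ same s u₀ * count u (iterX a k₃ (iterX b k₂ X)) + k₃ * (reach a s u₀ * count u (iterX a (pred k₃) (iterX b k₂ X)))
          + k₂ * (reach b s u₀ * count u (iterX a k₃ (iterX b (pred k₂) X))
                  + k₃ * (reach₂ b a s u₀ * count u (iterX a (pred k₃) (iterX b (pred k₂) X))))
      count-ba-good a b k₂ k₃ u₀ X u s-good =
        count-ba-∷ a b k₂ k₃ _ u₀ X u (saturates s-good) (saturates s-good)
                   (λ s′∈ → saturates (good-step s-good s′∈))

    paths-∷ : ∀ {m} a b → a ≢ b → ∀ k₁ k₂ k₃ t₀ u₀ (t u : Vec Sub m) → Good t₀ →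
      paths a b k₁ k₂ k₃ (t₀ ∷ t) (u₀ ∷ u)
      ≡ weighted (same t₀ u₀) (reach a t₀ u₀) (reach b t₀ u₀) (reach₂ a b t₀ u₀) (reach₂ b a t₀ u₀)
                 (λ i j l → paths a b i j l t u) k₁ k₂ k₃
    paths-∷ a b a≢b k₁ k₂ k₃ t₀ u₀ t u t₀-good = begin
      paths a b k₁ k₂ k₃ (t₀ ∷ t) (u₀ ∷ u)
        ≡⟨ count-iterX-∷ (∘-linear (iterX-linear a k₃) (iterX-linear b k₂)) a k₁ t₀ [ t ] (u₀ ∷ u) (saturates t₀-good) ⟩
      count (u₀ ∷ u) (iterX a k₃ (iterX b k₂ (map (t₀ ∷_) (iterX a k₁ [ t ]))))
        + k₁ * sum (map (λ s → count (u₀ ∷ u) (iterX a k₃ (iterX b k₂ (map (s ∷_) R₁)))) (Xi a t₀))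
        ≡⟨ cong₂ (λ x y → x + k₁ * y) (count-ba-good a b k₂ k₃ u₀ (iterX a k₁ [ t ]) u t₀-good) grown-sum ⟩
      same t₀ u₀ * N k₁ k₂ k₃ + k₃ * (reach a t₀ u₀ * N k₁ k₂ (pred k₃))
        + k₂ * (reach b t₀ u₀ * N k₁ (pred k₂) k₃ + k₃ * (reach₂ b a t₀ u₀ * N k₁ (pred k₂) (pred k₃)))
        + k₁ * (reach a t₀ u₀ * N (pred k₁) k₂ k₃ + k₂ * (reach₂ a b t₀ u₀ * N (pred k₁) (pred k₂) k₃))
        ≡⟨ rearrange (same t₀ u₀) (reach a t₀ u₀) (reach b t₀ u₀) (reach₂ a b t₀ u₀) (reach₂ b a t₀ u₀) k₁ k₂ k₃
                     (N k₁ k₂ k₃) (N k₁ k₂ (pred k₃)) (N k₁ (pred k₂) k₃) (N k₁ (pred k₂) (pred k₃))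
                     (N (pred k₁) k₂ k₃) (N (pred k₁) (pred k₂) k₃) ⟩
      weighted (same t₀ u₀) (reach a t₀ u₀) (reach b t₀ u₀) (reach₂ a b t₀ u₀) (reach₂ b a t₀ u₀) N k₁ k₂ k₃ ∎
      where
      open ≡-Reasoning
      N : Counts
      N i j l = paths a b i j l t u
      R₁ = iterX a (pred k₁) [ t ]

      rearrange : ∀ e ia ib iab iba k₁ k₂ k₃ x x₃ x₂ x₂₃ x₁ x₁₂ →
        e * x + k₃ * (ia * x₃) + k₂ * (ib * x₂ + k₃ * (iba * x₂₃)) + k₁ * (ia * x₁ + k₂ * (iab * x₁₂))
        ≡ e * x + ia * (k₁ * x₁ + k₃ * x₃) + ib * (k₂ * x₂) + iab * (k₁ * (k₂ * x₁₂)) + iba * (k₂ * (k₃ * x₂₃))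
      rearrange = solve-∀

      drop-zeros : ∀ e x k₃ y k₂ i x′ y′ →
                   e * x + k₃ * (0 * y) + k₂ * (i * x′ + k₃ * (0 * y′)) ≡ e * x + k₂ * (i * x′)
      drop-zeros = solve-∀

      grown-sum : sum (map (λ s → count (u₀ ∷ u) (iterX a k₃ (iterX b k₂ (map (s ∷_) R₁)))) (Xi a t₀))
                  ≡ reach a t₀ u₀ * N (pred k₁) k₂ k₃ + k₂ * (reach₂ a b t₀ u₀ * N (pred k₁) (pred k₂) k₃)
      grown-sum = begin
        sum (map (λ s → count (u₀ ∷ u) (iterX a k₃ (iterX b k₂ (map (s ∷_) R₁)))) (Xi a t₀))
          ≡⟨ sum-map-cong-∈ (Xi a t₀) each ⟩
        sum (map (λ s → same s u₀ * M₁ + k₂ * (reach b s u₀ * M₂)) (Xi a t₀))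
          ≡⟨ sum-map-+ (λ s → same s u₀ * M₁) (λ s → k₂ * (reach b s u₀ * M₂)) (Xi a t₀) ⟩
        sum (map (λ s → same s u₀ * M₁) (Xi a t₀)) + sum (map (λ s → k₂ * (reach b s u₀ * M₂)) (Xi a t₀))
          ≡⟨ cong₂ _+_ (sum-map-*ʳ M₁ (λ s → same s u₀) (Xi a t₀))
                       (trans (sum-map-*ˡ k₂ (λ s → reach b s u₀ * M₂) (Xi a t₀))
                              (cong (k₂ *_) (sum-map-*ʳ M₂ (λ s → reach b s u₀) (Xi a t₀)))) ⟩
        reach a t₀ u₀ * M₁ + k₂ * (reach₂ a b t₀ u₀ * M₂) ∎
        where
        M₁ = N (pred k₁) k₂ k₃
        M₂ = N (pred k₁) (pred k₂) k₃
        each : ∀ {s} → s ∈ Xi a t₀ → count (u₀ ∷ u) (iterX a k₃ (iterX b k₂ (map (s ∷_) R₁)))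
                                     ≡ same s u₀ * M₁ + k₂ * (reach b s u₀ * M₂)
        each {s} s∈ = trans (count-ba-good a b k₂ k₃ u₀ R₁ u (good-step t₀-good s∈))
          (trans (cong₂ (λ x y → same s u₀ * M₁ + k₃ * (x * N (pred k₁) k₂ (pred k₃))
                                 + k₂ * (reach b s u₀ * M₂ + k₃ * (y * N (pred k₁) (pred k₂) (pred k₃))))
                        no-a-step no-ba-step)
                 (drop-zeros (same s u₀) M₁ k₃ (N (pred k₁) k₂ (pred k₃)) k₂ (reach b s u₀) M₂
                             (N (pred k₁) (pred k₂) (pred k₃))))
          where
          no-a-step : reach a s u₀ ≡ 0
          no-a-step = cong (λ L → sum (map (λ s′ → same s′ u₀) L)) (saturates t₀-good s∈)
          no-ba-step : reach₂ b a s u₀ ≡ 0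
          no-ba-step = sum-map-zero (Xi b s) λ s′∈ →
            cong (λ L → sum (map (λ s″ → same s″ u₀) L)) (saturates₂ a≢b t₀-good s∈ s′∈)

-- The weight vectors (same, reach a, reach b, reach₂ a b, reach₂ b a) that one coordinate can have.
data IsPattern : ℕ → ℕ → ℕ → ℕ → ℕ → Set where
  stay-weights  : IsPattern 1 0 0 0 0
  a-weights     : IsPattern 0 1 0 0 0
  b-weights     : IsPattern 0 0 1 0 0
  ab-weights    : IsPattern 0 0 0 1 0
  ba-weights    : IsPattern 0 0 0 0 1
  ab-ba-weights : IsPattern 0 0 0 1 1
  no-weights    : IsPattern 0 0 0 0 0

routeOf : ℕ → ℕ → ℕ → ℕ → ℕ → Route
routeOf 1 0 0 0 0 = stay
routeOf 0 1 0 0 0 = via-a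
routeOf 0 0 1 0 0 = via-b
routeOf 0 0 0 1 0 = via-ab
routeOf 0 0 0 0 1 = via-ba
routeOf 0 0 0 1 1 = via-ab-ba
routeOf _ _ _ _ _ = unreachable

routeOf-swap : ∀ {e ia ib iab iba} → IsPattern e ia ib iab iba →
               routeOf e ib ia iba iab ≡ swapRoute (routeOf e ia ib iab iba)
routeOf-swap stay-weights  = refl
routeOf-swap a-weights     = refl
routeOf-swap b-weights     = refl
routeOf-swap ab-weights    = refl
routeOf-swap ba-weights    = refl
routeOf-swap ab-ba-weights = refl
routeOf-swap no-weights    = refl

private
  pick-x : ∀ x a b c d → 1 * x + 0 * a + 0 * b + 0 * c + 0 * d ≡ x
  pick-x = solve-∀
  pick-a : ∀ x a b c d → 0 * x + 1 * a + 0 * b + 0 * c + 0 * d ≡ a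
  pick-a = solve-∀
  pick-b : ∀ x a b c d → 0 * x + 0 * a + 1 * b + 0 * c + 0 * d ≡ b
  pick-b = solve-∀
  pick-ab : ∀ x a b c d → 0 * x + 0 * a + 0 * b + 1 * c + 0 * d ≡ c
  pick-ab = solve-∀
  pick-ba : ∀ x a b c d → 0 * x + 0 * a + 0 * b + 0 * c + 1 * d ≡ d
  pick-ba = solve-∀
  pick-ab+ba : ∀ x a b c d → 0 * x + 0 * a + 0 * b + 1 * c + 1 * d ≡ c + d
  pick-ab+ba = solve-∀
  pick-none : ∀ x a b c d → 0 * x + 0 * a + 0 * b + 0 * c + 0 * d ≡ 0
  pick-none = solve-∀

weighted-pattern : ∀ {e ia ib iab iba} → IsPattern e ia ib iab iba → ∀ N k₁ k₂ k₃ →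
                   weighted e ia ib iab iba N k₁ k₂ k₃ ≡ pathStep (routeOf e ia ib iab iba) N k₁ k₂ k₃
weighted-pattern p N k₁ k₂ k₃ = by-pattern p
  where
  x xa xb xab xba : ℕ
  x   = pathStep stay   N k₁ k₂ k₃
  xa  = pathStep via-a  N k₁ k₂ k₃
  xb  = pathStep via-b  N k₁ k₂ k₃
  xab = pathStep via-ab N k₁ k₂ k₃
  xba = pathStep via-ba N k₁ k₂ k₃

  by-pattern : ∀ {e ia ib iab iba} → IsPattern e ia ib iab iba →
               e * x + ia * xa + ib * xb + iab * xab + iba * xba ≡ pathStep (routeOf e ia ib iab iba) N k₁ k₂ k₃
  by-pattern stay-weights  = pick-x     x xa xb xab xba
  by-pattern a-weights     = pick-a     x xa xb xab xba
  by-pattern b-weights     = pick-b     x xa xb xab xba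
  by-pattern ab-weights    = pick-ab    x xa xb xab xba
  by-pattern ba-weights    = pick-ba    x xa xb xab xba
  by-pattern ab-ba-weights = pick-ab+ba x xa xb xab xba
  by-pattern no-weights    = pick-none  x xa xb xab xba

weighted-cong : ∀ e ia ib iab iba {N M : Counts} → (∀ i j l → N i j l ≡ M i j l) →
                ∀ k₁ k₂ k₃ → weighted e ia ib iab iba N k₁ k₂ k₃ ≡ weighted e ia ib iab iba M k₁ k₂ k₃
weighted-cong e ia ib iab iba N≡M k₁ k₂ k₃
  rewrite N≡M k₁ k₂ k₃ | N≡M (pred k₁) k₂ k₃ | N≡M k₁ k₂ (pred k₃) | N≡M k₁ (pred k₂) k₃
        | N≡M (pred k₁) (pred k₂) k₃ | N≡M k₁ (pred k₂) (pred k₃) = refl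

module _ {n : ℕ} where

  hit : Maybe (Subset n) → Subset n → ℕ
  hit nothing  u = 0
  hit (just s) u = same s u

  Apart : Maybe (Subset n) → Maybe (Subset n) → Set
  Apart o o′ = ∀ {s s′} → o ≡ just s → o′ ≡ just s′ → s ≢ s′

  private
    hit-cases : ∀ o u → hit o u ≡ 0 ⊎ (hit o u ≡ 1 × o ≡ just u)
    hit-cases nothing  u = inj₁ refl
    hit-cases (just s) u with s ≟ˢ u
    ... | yes refl = inj₂ (refl , refl)
    ... | no  _    = inj₁ refl

    miss : ∀ {o u} o′ → Apart o o′ → o ≡ just u → hit o′ u ≡ 0
    miss nothing  o#o′ o≡u = refl
    miss {u = u} (just s) o#o′ o≡u with s ≟ˢ u
    ... | yes s≡u = contradiction (sym s≡u) (o#o′ o≡u refl)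
    ... | no  _   = refl

  classify : ∀ t u {A B AB BA} →
             Apart (just t) A → Apart (just t) B → Apart (just t) AB → Apart (just t) BA →
             Apart A B → Apart A AB → Apart A BA → Apart B AB → Apart B BA →
             IsPattern (same t u) (hit A u) (hit B u) (hit AB u) (hit BA u)
  classify t u {A} {B} {AB} {BA} t#A t#B t#AB t#BA A#B A#AB A#BA B#AB B#BA with t ≟ˢ u
  ... | yes refl rewrite miss A t#A refl | miss B t#B refl | miss AB t#AB refl | miss BA t#BA refl = stay-weights
  ... | no  _ with hit-cases A u
  ...   | inj₂ (hitA , refl) rewrite hitA | miss B A#B refl | miss AB A#AB refl | miss BA A#BA refl = a-weights
  ...   | inj₁ missA with hit-cases B u
  ...     | inj₂ (hitB , refl) rewrite missA | hitB | miss AB B#AB refl | miss BA B#BA refl = b-weights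
  ...     | inj₁ missB with hit-cases AB u | hit-cases BA u
  ...       | inj₁ missAB       | inj₁ missBA       rewrite missA | missB | missAB | missBA = no-weights
  ...       | inj₂ (hitAB , _)  | inj₁ missBA       rewrite missA | missB | hitAB  | missBA = ab-weights
  ...       | inj₁ missAB       | inj₂ (hitBA , _)  rewrite missA | missB | missAB | hitBA  = ba-weights
  ...       | inj₂ (hitAB , _)  | inj₂ (hitBA , _)  rewrite missA | missB | hitAB  | hitBA  = ab-ba-weights

module Routes {n g : ℕ} (Γ : SimpleGraph g) (P : FinPoset n) (κ : Fin n → Fin g)
              (ec : EC Γ P κ) (na : NA Γ P κ) (ice : ICE2 Γ P κ) where

  open IdealGrowth Γ P κ ec na ice
  open Tuples Γ P κ

  grownBy : ∀ {a I} → Growth a I → Maybe (Subset n)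
  grownBy         (stuck _)     = nothing
  grownBy {I = I} (grows x _ _) = just (I ∪ ⁅ x ⁆)

  grownBy₂ : ∀ {a I} → Fin g → Growth a I → Maybe (Subset n)
  grownBy₂         b (stuck _)     = nothing
  grownBy₂ {I = I} b (grows x _ _) = grownBy (growth b (I ∪ ⁅ x ⁆))

  reach-grown : ∀ a I u → reach a I u ≡ hit (grownBy (growth a I)) u
  reach-grown a I u with growth a I
  ... | stuck none     = cong (λ L → sum (map (λ s → same s u) L)) none
  ... | grows x _ single = trans (cong (λ L → sum (map (λ s → same s u) L)) single) (+-identityʳ _)

  reach₂-grown : ∀ a b I u → reach₂ a b I u ≡ hit (grownBy₂ b (growth a I)) u
  reach₂-grown a b I u with growth a I
  ... | stuck none     = cong (λ L → sum (map (λ s → reach b s u) L)) none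
  ... | grows x _ single = trans (cong (λ L → sum (map (λ s → reach b s u) L)) single)
                               (trans (+-identityʳ _) (reach-grown b (I ∪ ⁅ x ⁆) u))

  private
    grownBy⁻ : ∀ {a I} (γ : Growth a I) {s} → grownBy γ ≡ just s → ∃ λ x → MinOut a I x × s ≡ I ∪ ⁅ x ⁆
    grownBy⁻ (grows x x-min _) refl = x , x-min , refl

    grownBy₂⁻ : ∀ {a I} b (γ : Growth a I) {s} → grownBy₂ b γ ≡ just s →
                ∃₂ λ x y → MinOut a I x × MinOut b (I ∪ ⁅ x ⁆) y × s ≡ (I ∪ ⁅ x ⁆) ∪ ⁅ y ⁆
    grownBy₂⁻ {I = I} b (grows x x-min _) e with grownBy⁻ (growth b (I ∪ ⁅ x ⁆)) e
    ... | y , y-min , refl = x , y , x-min , y-min , refl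

    differ : ∀ {s s′ : Subset n} {z} → z ∉ˢ s → z ∈ˢ s′ → s ≢ s′
    differ z∉s z∈s′ refl = z∉s z∈s′

    colours-differ : ∀ {a b x y} → a ≢ b → κ x ≡ a → κ y ≡ b → x ≢ y
    colours-differ a≢b κx≡a κy≡b refl = a≢b (trans (sym κx≡a) κy≡b)

    I#A : ∀ a I → Apart (just I) (grownBy (growth a I))
    I#A a I refl e with grownBy⁻ (growth a I) e
    ... | x , (x∉I , _) , refl = differ x∉I (x∈p∪⁅x⁆ I x)

    I#AB : ∀ a b I → Apart (just I) (grownBy₂ b (growth a I))
    I#AB a b I refl e with grownBy₂⁻ b (growth a I) e
    ... | x , y , (x∉I , _) , _ , refl = differ x∉I (x∈p⇒x∈p∪⁅y⁆ y (x∈p∪⁅x⁆ I x))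

    A#B : ∀ {a b} → a ≢ b → ∀ I → Apart (grownBy (growth a I)) (grownBy (growth b I))
    A#B {a} {b} a≢b I e e′ with grownBy⁻ (growth a I) e | grownBy⁻ (growth b I) e′
    ... | x , (x∉I , κx≡a , _) , refl | y , (_ , κy≡b , _) , refl =
      ≢-sym (differ (x∉p∪⁅y⁆ x∉I (colours-differ a≢b κx≡a κy≡b)) (x∈p∪⁅x⁆ I x))

    A#AB : ∀ a b I → Apart (grownBy (growth a I)) (grownBy₂ b (growth a I))
    A#AB a b I e e′ with grownBy⁻ (growth a I) e | grownBy₂⁻ b (growth a I) e′
    ... | x , x-min , refl | x′ , y , x′-min , (y∉ , _) , refl with MinOut-unique x-min x′-min
    ...   | refl = differ y∉ (x∈p∪⁅x⁆ (I ∪ ⁅ x ⁆) y)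

    A#BA : ∀ {a b} → a ≢ b → ∀ I → Apart (grownBy (growth a I)) (grownBy₂ a (growth b I))
    A#BA {a} {b} a≢b I e e′ with grownBy⁻ (growth a I) e | grownBy₂⁻ a (growth b I) e′
    ... | x , (_ , κx≡a , _) , refl | y , x′ , (y∉I , κy≡b , _) , _ , refl =
      differ (x∉p∪⁅y⁆ y∉I (≢-sym (colours-differ a≢b κx≡a κy≡b))) (x∈p⇒x∈p∪⁅y⁆ x′ (x∈p∪⁅x⁆ I y))

  weights-pattern : ∀ {a b} → a ≢ b → ∀ I u →
                    IsPattern (same I u) (reach a I u) (reach b I u) (reach₂ a b I u) (reach₂ b a I u)
  weights-pattern {a} {b} a≢b I u
    rewrite reach-grown a I u | reach-grown b I u | reach₂-grown a b I u | reach₂-grown b a I u =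
    classify I u (I#A a I) (I#A b I) (I#AB a b I) (I#AB b a I)
             (A#B a≢b I) (A#AB a b I) (A#BA a≢b I) (A#BA (≢-sym a≢b) I) (A#AB b a I)

  open PathCounting (IsIdeal P) ∈-Xideal-saturated ∈-Xideal-ideal ∈-Xideal-saturated₂

  routes : ∀ {m} → Fin g → Fin g → Vec (Subset n) m → Vec (Subset n) m → List Route
  routes a b []       []       = []
  routes a b (t₀ ∷ t) (u₀ ∷ u) =
    routeOf (same t₀ u₀) (reach a t₀ u₀) (reach b t₀ u₀) (reach₂ a b t₀ u₀) (reach₂ b a t₀ u₀) ∷ routes a b t u

  routes-swap : ∀ {m a b} → a ≢ b → (t u : Vec (Subset n) m) → routes b a t u ≡ map swapRoute (routes a b t u)
  routes-swap a≢b []       []       = refl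
  routes-swap a≢b (t₀ ∷ t) (u₀ ∷ u) = cong₂ _∷_ (routeOf-swap (weights-pattern a≢b t₀ u₀)) (routes-swap a≢b t u)

  paths-[] : ∀ a b k₁ k₂ k₃ → paths a b k₁ k₂ k₃ [] [] ≡ δ₀ k₁ k₂ k₃
  paths-[] a b zero     zero     zero     = refl
  paths-[] a b zero     zero     (suc k₃) = cong (count []) (concatMap-[] (iterX a k₃ [ [] ]))
  paths-[] a b zero     (suc k₂) k₃       =
    trans (cong (count [] ∘ iterX a k₃) (concatMap-[] (iterX b k₂ [ [] ]))) (cong (count []) (iterX-[] a k₃))
  paths-[] a b (suc k₁) k₂       k₃       =
    trans (cong (count [] ∘ iterX a k₃ ∘ iterX b k₂) (concatMap-[] (iterX a k₁ [ [] ])))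
          (trans (cong (count [] ∘ iterX a k₃) (iterX-[] b k₂)) (cong (count []) (iterX-[] a k₃)))

  paths≡pathCount : ∀ {m a b} → a ≢ b → (t u : Vec (Subset n) m) → All (IsIdeal P) t →
                    ∀ k₁ k₂ k₃ → paths a b k₁ k₂ k₃ t u ≡ pathCount (routes a b t u) k₁ k₂ k₃
  paths≡pathCount a≢b []       []       []                       = paths-[] _ _
  paths≡pathCount {a = a} {b} a≢b (t₀ ∷ t) (u₀ ∷ u) (t₀-ideal ∷ t-ideal) k₁ k₂ k₃ =
    trans (paths-∷ a b a≢b k₁ k₂ k₃ t₀ u₀ t u t₀-ideal)
    (trans (weighted-cong (same t₀ u₀) (reach a t₀ u₀) (reach b t₀ u₀) (reach₂ a b t₀ u₀) (reach₂ b a t₀ u₀)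
                          (paths≡pathCount a≢b t u t-ideal) k₁ k₂ k₃)
           (weighted-pattern (weights-pattern a≢b t₀ u₀) (pathCount (routes a b t u)) k₁ k₂ k₃))

private
  toℚᵘ-ℕtoℚ : ∀ a → toℚᵘ (ℕtoℚ a) ℚᵘ.≃ ℚᵘ.mkℚᵘ (ℤ.+ a) 0
  toℚᵘ-ℕtoℚ a = ℚ.toℚᵘ-fromℚᵘ (ℚᵘ.mkℚᵘ (ℤ.+ a) 0)

ℕtoℚ-+ : ∀ a b → ℕtoℚ (a + b) ≡ ℕtoℚ a ℚ.+ ℕtoℚ b
ℕtoℚ-+ a b = ℚ.toℚᵘ-injective (ℚᵘ.≃-trans (toℚᵘ-ℕtoℚ (a + b)) (ℚᵘ.≃-sym
  (ℚᵘ.≃-trans (ℚ.toℚᵘ-homo-+ (ℕtoℚ a) (ℕtoℚ b)) (ℚᵘ.≃-trans (ℚᵘ.+-cong (toℚᵘ-ℕtoℚ a) (toℚᵘ-ℕtoℚ b))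
    (ℚᵘ.*≡* (trans (cross (ℤ.+ a) (ℤ.+ b)) (cong (ℤ._* ℤ.1ℤ) (sym (ℤ.pos-+ a b)))))))))
  where
  cross : ∀ x y → (x ℤ.* ℤ.1ℤ ℤ.+ y ℤ.* ℤ.1ℤ) ℤ.* ℤ.1ℤ ≡ (x ℤ.+ y) ℤ.* (ℤ.1ℤ ℤ.* ℤ.1ℤ)
  cross = ℤ-Solver.solve-∀

ℕtoℚ-* : ∀ a b → ℕtoℚ (a ℕ.* b) ≡ ℕtoℚ a ℚ.* ℕtoℚ b
ℕtoℚ-* a b = ℚ.toℚᵘ-injective (ℚᵘ.≃-trans (toℚᵘ-ℕtoℚ (a ℕ.* b)) (ℚᵘ.≃-sym
  (ℚᵘ.≃-trans (ℚ.toℚᵘ-homo-* (ℕtoℚ a) (ℕtoℚ b)) (ℚᵘ.≃-trans (ℚᵘ.*-cong (toℚᵘ-ℕtoℚ a) (toℚᵘ-ℕtoℚ b))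
    (ℚᵘ.*≡* (trans (cross (ℤ.+ a) (ℤ.+ b)) (cong (ℤ._* (ℤ.1ℤ ℤ.* ℤ.1ℤ)) (sym (ℤ.pos-* a b)))))))))
  where
  cross : ∀ x y → (x ℤ.* y) ℤ.* ℤ.1ℤ ≡ (x ℤ.* y) ℤ.* (ℤ.1ℤ ℤ.* ℤ.1ℤ)
  cross = ℤ-Solver.solve-∀

ℕtoℚ-*-/ : ∀ d .{{_ : ℕ.NonZero d}} → ℕtoℚ d ℚ.* (ℤ.+ 1 ℚ./ d) ≡ 1ℚ
ℕtoℚ-*-/ (suc d) = ℚ.toℚᵘ-injective (ℚᵘ.≃-trans (ℚ.toℚᵘ-homo-* (ℕtoℚ (suc d)) (ℤ.+ 1 ℚ./ suc d))
  (ℚᵘ.≃-trans (ℚᵘ.*-cong (toℚᵘ-ℕtoℚ (suc d)) (ℚ.toℚᵘ-fromℚᵘ (ℚᵘ.mkℚᵘ (ℤ.+ 1) d)))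
  (ℚᵘ.≃-trans (ℚᵘ.*≡* (cross (ℤ.+ suc d))) (ℚᵘ.≃-sym (ℚ.toℚᵘ-fromℚᵘ (ℚᵘ.mkℚᵘ (ℤ.+ 1) 0))))))
  where
  cross : ∀ x → (x ℤ.* ℤ.1ℤ) ℤ.* ℤ.1ℤ ≡ ℤ.1ℤ ℤ.* (ℤ.1ℤ ℤ.* x)
  cross = ℤ-Solver.solve-∀

inv! : ℕ → ℚ
inv! k = (ℤ.+ 1 ℚ./ (k !)) {{k !≢0}}

ℕtoℚ-scaled : ∀ k₁ k₂ k₃ x → ℕtoℚ (scaled k₁ k₂ k₃ x) ℚ.* (inv! k₃ ℚ.* (inv! k₂ ℚ.* (inv! k₁ ℚ.* 1ℚ))) ≡ ℕtoℚ x
ℕtoℚ-scaled k₁ k₂ k₃ x = begin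
  ℕtoℚ (k₁ ! ℕ.* (k₂ ! ℕ.* (k₃ ! ℕ.* x))) ℚ.* (i₃ ℚ.* (i₂ ℚ.* (i₁ ℚ.* 1ℚ)))
    ≡⟨ cong (ℚ._* (i₃ ℚ.* (i₂ ℚ.* (i₁ ℚ.* 1ℚ))))
            (trans (ℕtoℚ-* (k₁ !) _) (cong (F₁ ℚ.*_) (trans (ℕtoℚ-* (k₂ !) _) (cong (F₂ ℚ.*_) (ℕtoℚ-* (k₃ !) x))))) ⟩
  (F₁ ℚ.* (F₂ ℚ.* (F₃ ℚ.* x̂))) ℚ.* (i₃ ℚ.* (i₂ ℚ.* (i₁ ℚ.* 1ℚ)))
    ≡⟨ solve 7 (λ F₁ F₂ F₃ y i₁ i₂ i₃ → (F₁ :* (F₂ :* (F₃ :* y))) :* (i₃ :* (i₂ :* (i₁ :* con 1ℚ)))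
                                      := (F₁ :* i₁) :* ((F₂ :* i₂) :* ((F₃ :* i₃) :* y))) refl F₁ F₂ F₃ x̂ i₁ i₂ i₃ ⟩
  (F₁ ℚ.* i₁) ℚ.* ((F₂ ℚ.* i₂) ℚ.* ((F₃ ℚ.* i₃) ℚ.* x̂))
    ≡⟨ cong₃ (λ u v w → u ℚ.* (v ℚ.* (w ℚ.* x̂))) (cancel k₁) (cancel k₂) (cancel k₃) ⟩
  1ℚ ℚ.* (1ℚ ℚ.* (1ℚ ℚ.* x̂))
    ≡⟨ trans (ℚ.*-identityˡ _) (trans (ℚ.*-identityˡ _) (ℚ.*-identityˡ x̂)) ⟩
  x̂ ∎
  where
  open ≡-Reasoning
  open +-*-Solver
  F₁ = ℕtoℚ (k₁ !)
  F₂ = ℕtoℚ (k₂ !)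
  F₃ = ℕtoℚ (k₃ !)
  x̂  = ℕtoℚ x
  i₁ = inv! k₁
  i₂ = inv! k₂
  i₃ = inv! k₃
  cancel : ∀ k → ℕtoℚ (k !) ℚ.* inv! k ≡ 1ℚ
  cancel k = ℕtoℚ-*-/ (k !) {{k !≢0}}
  cong₃ : ∀ (f : ℚ → ℚ → ℚ → ℚ) {a b c a′ b′ c′} → a ≡ a′ → b ≡ b′ → c ≡ c′ → f a b c ≡ f a′ b′ c′
  cong₃ f refl refl refl = refl

module _ {n m : ℕ} where

  private
    Tuple : Set
    Tuple = Vec (Subset n) m

  uniform : ℚ → List Tuple → Combo n m
  uniform w = map (w ,_)

  scale-uniform : ∀ s w vs → scale s (uniform w vs) ≡ uniform (s ℚ.* w) vs
  scale-uniform s w []       = refl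
  scale-uniform s w (v ∷ vs) = cong ((s ℚ.* w , v) ∷_) (scale-uniform s w vs)

  coeffTuple-∷ : ∀ u c v (L : Combo n m) →
                 coeffTuple u ((c , v) ∷ L) ≡ (if v ≟T u then c ℚ.+ coeffTuple u L else coeffTuple u L)
  coeffTuple-∷ u c v L with v ≟T u
  ... | true  = refl
  ... | false = refl

  coeffTuple-++ : ∀ u (L L′ : Combo n m) → coeffTuple u (L ++ L′) ≡ coeffTuple u L ℚ.+ coeffTuple u L′
  coeffTuple-++ u []            L′ = sym (ℚ.+-identityˡ _)
  coeffTuple-++ u ((c , v) ∷ L) L′ with v ≟T u
  ... | true  = trans (cong (c ℚ.+_) (coeffTuple-++ u L L′)) (sym (ℚ.+-assoc c _ _))
  ... | false = coeffTuple-++ u L L′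

  coeffTuple-concatMap : ∀ {A : Set} u (f : A → Combo n m) xs →
                         coeffTuple u (concatMap f xs) ≡ sumℚ (map (coeffTuple u ∘ f) xs)
  coeffTuple-concatMap u f []       = refl
  coeffTuple-concatMap u f (x ∷ xs) =
    trans (coeffTuple-++ u (f x) (concatMap f xs)) (cong (coeffTuple u (f x) ℚ.+_) (coeffTuple-concatMap u f xs))

  coeffTuple-scale : ∀ u s (L : Combo n m) → coeffTuple u (scale s L) ≡ s ℚ.* coeffTuple u L
  coeffTuple-scale u s []            = sym (ℚ.*-zeroʳ s)
  coeffTuple-scale u s ((c , v) ∷ L) with v ≟T u
  ... | true  = trans (cong (s ℚ.* c ℚ.+_) (coeffTuple-scale u s L)) (sym (ℚ.*-distribˡ-+ s c _))
  ... | false = coeffTuple-scale u s L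

  coeffTuple-uniform : ∀ u w vs → coeffTuple u (uniform w vs) ≡ ℕtoℚ (count u vs) ℚ.* w
  coeffTuple-uniform u w []       = sym (ℚ.*-zeroˡ w)
  coeffTuple-uniform u w (v ∷ vs) with v ≟T u
  ... | true  = trans (cong (w ℚ.+_) (coeffTuple-uniform u w vs)) (sym (trans (cong (ℚ._* w) (ℕtoℚ-+ 1 (count u vs)))
                  (trans (ℚ.*-distribʳ-+ w 1ℚ (ℕtoℚ (count u vs))) (cong (ℚ._+ ℕtoℚ (count u vs) ℚ.* w) (ℚ.*-identityˡ w)))))
  ... | false = coeffTuple-uniform u w vs

module Brackets {n g : ℕ} (Γ : SimpleGraph g) (P : FinPoset n) (κ : Fin n → Fin g) where

  open Tuples Γ P κ using (iterX; paths)

  X-uniform : ∀ {m} a w (vs : List (Vec (Subset n) m)) →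
              X Γ P κ a (uniform w vs) ≡ uniform w (concatMap (Xtuple Γ P κ a) vs)
  X-uniform a w []       = refl
  X-uniform a w (v ∷ vs) = trans (cong (uniform w (Xtuple Γ P κ a v) ++_) (X-uniform a w vs))
                                 (sym (map-++ (w ,_) (Xtuple Γ P κ a v) _))

  Xpow-uniform : ∀ {m} a k w (vs : List (Vec (Subset n) m)) → Xpow Γ P κ a k (uniform w vs) ≡ uniform w (iterX a k vs)
  Xpow-uniform a zero    w vs = refl
  Xpow-uniform a (suc k) w vs = trans (cong (X Γ P κ a) (Xpow-uniform a k w vs)) (X-uniform a w (iterX a k vs))

  divPow-uniform : ∀ {m} a k w (vs : List (Vec (Subset n) m)) →
                   ⟨_^_⟩ Γ P κ a k (uniform w vs) ≡ uniform (inv! k ℚ.* w) (iterX a k vs)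
  divPow-uniform a k w vs = trans (cong (scale (inv! k)) (Xpow-uniform a k w vs)) (scale-uniform (inv! k) w (iterX a k vs))

  divPow₃-basis : ∀ {m} d₃ k₃ d₂ k₂ d₁ k₁ (t : Vec (Subset n) m) →
    ⟨_^_,_^_,_^_⟩ Γ P κ d₃ k₃ d₂ k₂ d₁ k₁ (basis t)
    ≡ uniform (inv! k₃ ℚ.* (inv! k₂ ℚ.* (inv! k₁ ℚ.* 1ℚ))) (iterX d₃ k₃ (iterX d₂ k₂ (iterX d₁ k₁ [ t ])))
  divPow₃-basis d₃ k₃ d₂ k₂ d₁ k₁ t =
    trans (cong (⟨_^_⟩ Γ P κ d₃ k₃ ∘ ⟨_^_⟩ Γ P κ d₂ k₂) (divPow-uniform d₁ k₁ 1ℚ [ t ]))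
    (trans (cong (⟨_^_⟩ Γ P κ d₃ k₃) (divPow-uniform d₂ k₂ _ (iterX d₁ k₁ [ t ])))
           (divPow-uniform d₃ k₃ _ _))

module _ {n m : ℕ} where

  private
    Tuple : Set
    Tuple = Vec (Subset n) m

    _≟ᵗ_ : (t u : Tuple) → Dec (t ≡ u)
    _≟ᵗ_ = Vec.≡-dec (Vec.≡-dec Bool._≟_)

    ≟T-refl : ∀ t → t ≟T t ≡ true
    ≟T-refl t = trans (isYes≗does (t ≟ᵗ t)) (dec-true (t ≟ᵗ t) refl)

    ≟T-≢ : ∀ {t v} → t ≢ v → t ≟T v ≡ false
    ≟T-≢ {t} {v} t≢v = trans (isYes≗does (t ≟ᵗ v)) (dec-false (t ≟ᵗ v) t≢v)

    when : Bool → ℚ → ℚ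
    when b c = if b then c else 0ℚ

    when-0ℚ : ∀ b → when b 0ℚ ≡ 0ℚ
    when-0ℚ true  = refl
    when-0ℚ false = refl

    sumℚ-map-+ : ∀ (f h : Tuple → ℚ) vs → sumℚ (map (λ v → f v ℚ.+ h v) vs) ≡ sumℚ (map f vs) ℚ.+ sumℚ (map h vs)
    sumℚ-map-+ f h []       = sym (ℚ.+-identityˡ 0ℚ)
    sumℚ-map-+ f h (v ∷ vs) = trans (cong (f v ℚ.+ h v ℚ.+_) (sumℚ-map-+ f h vs)) (interchange (f v) (h v) _ _)
      where
      open +-*-Solver
      interchange : ∀ a b c d → (a ℚ.+ b) ℚ.+ (c ℚ.+ d) ≡ (a ℚ.+ c) ℚ.+ (b ℚ.+ d)
      interchange = solve 4 (λ a b c d → (a :+ b) :+ (c :+ d) := (a :+ c) :+ (b :+ d)) refl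

    sumℚ-map-zero : ∀ (f : Tuple → ℚ) vs → (∀ {v} → v ∈ vs → f v ≡ 0ℚ) → sumℚ (map f vs) ≡ 0ℚ
    sumℚ-map-zero f []       f≡0 = refl
    sumℚ-map-zero f (v ∷ vs) f≡0 =
      trans (cong₂ ℚ._+_ (f≡0 (here refl)) (sumℚ-map-zero f vs (f≡0 ∘ there))) (ℚ.+-identityˡ 0ℚ)

    sumℚ-single : ∀ (π : Tuple → Bool) t c vs → Unique vs → t ∈ vs →
                  sumℚ (map (λ v → when (π v) (when (t ≟T v) c)) vs) ≡ when (π t) c
    sumℚ-single π t c (v ∷ vs) (v∉vs ∷ !vs) (here refl) =
      trans (cong₂ ℚ._+_ (cong (when (π t) ∘ (λ b → when b c)) (≟T-refl t))
                         (sumℚ-map-zero _ vs (λ {v′} v′∈ → trans (cong (when (π v′) ∘ (λ b → when b c)) (≟T-≢ (ListAll.lookup v∉vs v′∈)))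
                                                                 (when-0ℚ (π v′)))))
            (ℚ.+-identityʳ _)
    sumℚ-single π t c (v ∷ vs) (v∉vs ∷ !vs) (there t∈vs) =
      trans (cong₂ ℚ._+_ (trans (cong (when (π v) ∘ (λ b → when b c)) (≟T-≢ (λ t≡v → ListAll.lookup v∉vs t∈vs (sym t≡v))))
                                (when-0ℚ (π v)))
                         (sumℚ-single π t c vs !vs t∈vs))
            (ℚ.+-identityˡ _)

  coeffWhere : (Tuple → Bool) → Combo n m → ℚ
  coeffWhere π L = sumℚ (map proj₁ (filterᵇ (π ∘ proj₂) L))

  coeffWhere-by-tuple : ∀ π (L : Combo n m) vs → Unique vs → (∀ {e} → e ∈ L → proj₂ e ∈ vs) →
                        coeffWhere π L ≡ sumℚ (map (λ v → when (π v) (coeffTuple v L)) vs)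
  coeffWhere-by-tuple π []            vs !vs L⊆vs = sym (sumℚ-map-zero _ vs (λ {v} _ → when-0ℚ (π v)))
  coeffWhere-by-tuple π ((c , t) ∷ L) vs !vs L⊆vs = begin
    coeffWhere π ((c , t) ∷ L)
      ≡⟨ head-split ⟩
    when (π t) c ℚ.+ coeffWhere π L
      ≡⟨ cong₂ ℚ._+_ (sym (sumℚ-single π t c vs !vs (L⊆vs (here refl)))) (coeffWhere-by-tuple π L vs !vs (L⊆vs ∘ there)) ⟩
    sumℚ (map (λ v → when (π v) (when (t ≟T v) c)) vs) ℚ.+ sumℚ (map (λ v → when (π v) (coeffTuple v L)) vs)
      ≡⟨ sumℚ-map-+ _ _ vs ⟨
    sumℚ (map (λ v → when (π v) (when (t ≟T v) c) ℚ.+ when (π v) (coeffTuple v L)) vs)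
      ≡⟨ cong sumℚ (map-cong (λ v → trans (when-coeffTuple-∷ (π v) (t ≟T v))
                                          (cong (when (π v)) (sym (coeffTuple-∷ v c t L)))) vs) ⟩
    sumℚ (map (λ v → when (π v) (coeffTuple v ((c , t) ∷ L))) vs) ∎
    where
    open ≡-Reasoning
    head-split : coeffWhere π ((c , t) ∷ L) ≡ when (π t) c ℚ.+ coeffWhere π L
    head-split with π t
    ... | true  = refl
    ... | false = sym (ℚ.+-identityˡ _)
    when-coeffTuple-∷ : ∀ {v} b b′ → when b (when b′ c) ℚ.+ when b (coeffTuple v L)
                                   ≡ when b (if b′ then c ℚ.+ coeffTuple v L else coeffTuple v L)
    when-coeffTuple-∷ true  true  = refl
    when-coeffTuple-∷ true  false = ℚ.+-identityˡ _
    when-coeffTuple-∷ false _     = ℚ.+-identityˡ 0ℚ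

  ≈Tuple⇒≈Multiset : ∀ {L R : Combo n m} → L ≈Tuple R → L ≈Multiset R
  ≈Tuple⇒≈Multiset {L} {R} L≈R u = begin
    coeffWhere π L                                          ≡⟨ coeffWhere-by-tuple π L vs !vs (λ e∈ → covers (∈-++⁺ˡ e∈)) ⟩
    sumℚ (map (λ v → when (π v) (coeffTuple v L)) vs)       ≡⟨ cong sumℚ (map-cong (λ v → cong (when (π v)) (L≈R v)) vs) ⟩
    sumℚ (map (λ v → when (π v) (coeffTuple v R)) vs)       ≡⟨ coeffWhere-by-tuple π R vs !vs (λ e∈ → covers (∈-++⁺ʳ L e∈)) ⟨
    coeffWhere π R                                          ∎
    where
    open ≡-Reasoning
    π : Tuple → Bool
    π t = sameMultisetᵇ t u
    vs = deduplicate _≟ᵗ_ (map proj₂ (L ++ R))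
    !vs : Unique vs
    !vs = Unique.deduplicate-! _≟ᵗ_ (map proj₂ (L ++ R))
    covers : ∀ {e} → e ∈ L ++ R → proj₂ e ∈ vs
    covers e∈ = ∈-deduplicate⁺ _≟ᵗ_ (∈-map⁺ proj₂ e∈)

sumℚ-applyUpTo : ∀ (h f : ℕ → ℕ) k → sumℚ (map (ℕtoℚ ∘ h) (applyUpTo f k)) ≡ ℕtoℚ (sumBelow k (h ∘ f))
sumℚ-applyUpTo h f zero    = refl
sumℚ-applyUpTo h f (suc k) =
  trans (cong (ℕtoℚ (h (f 0)) ℚ.+_) (sumℚ-applyUpTo h (f ∘ suc) k)) (sym (ℕtoℚ-+ (h (f 0)) _))

module Coefficients {n g : ℕ} (Γ : SimpleGraph g) (P : FinPoset n) (κ : Fin n → Fin g)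
                    (ec : EC Γ P κ) (na : NA Γ P κ) (ice : ICE2 Γ P κ) where

  open Routes Γ P κ ec na ice using (routes; routes-swap; paths≡pathCount)
  open Brackets Γ P κ

  coeffTuple-divPow₃ : ∀ {m a b} → a ≢ b → (t : Vec (Subset n) m) → All (IsIdeal P) t → ∀ k₁ k₂ k₃ u →
    coeffTuple u (⟨_^_,_^_,_^_⟩ Γ P κ a k₃ b k₂ a k₁ (basis t)) ≡ ℕtoℚ (closedForm (tallyOf (routes a b t u)) k₁ k₂ k₃)
  coeffTuple-divPow₃ {a = a} {b} a≢b t t-ideal k₁ k₂ k₃ u = begin
    coeffTuple u (⟨_^_,_^_,_^_⟩ Γ P κ a k₃ b k₂ a k₁ (basis t))
      ≡⟨ cong (coeffTuple u) (divPow₃-basis a k₃ b k₂ a k₁ t) ⟩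
    coeffTuple u (uniform w (iterX a k₃ (iterX b k₂ (iterX a k₁ [ t ]))))
      ≡⟨ coeffTuple-uniform u w (iterX a k₃ (iterX b k₂ (iterX a k₁ [ t ]))) ⟩
    ℕtoℚ (paths a b k₁ k₂ k₃ t u) ℚ.* w
      ≡⟨ cong (λ N → ℕtoℚ N ℚ.* w) (trans (paths≡pathCount a≢b t u t-ideal k₁ k₂ k₃)
                                           (pathCount≡scaled-normCount (routes a b t u) k₁ k₂ k₃)) ⟩
    ℕtoℚ (scaled k₁ k₂ k₃ (normCount (routes a b t u) k₁ k₂ k₃)) ℚ.* w
      ≡⟨ ℕtoℚ-scaled k₁ k₂ k₃ _ ⟩
    ℕtoℚ (normCount (routes a b t u) k₁ k₂ k₃)
      ≡⟨ cong ℕtoℚ (normCount≡closedForm (routes a b t u) k₁ k₂ k₃) ⟩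
    ℕtoℚ (closedForm (tallyOf (routes a b t u)) k₁ k₂ k₃) ∎
    where
    open ≡-Reasoning
    open Tuples Γ P κ using (iterX; paths)
    w = inv! k₃ ℚ.* (inv! k₂ ℚ.* (inv! k₁ ℚ.* 1ℚ))

  leftSide rightSide : ∀ {m} → Fin g → Fin g → (p q r : ℕ) → Vec (Subset n) m → Combo n m
  leftSide  b c p q r t = ⟨_^_,_^_,_^_⟩ Γ P κ c q b p c r (basis t)
  rightSide b c p q r t = concatMap (λ k → scale (ℕtoℚ ((q + r ∸ p) C (q ∸ k)))
                                                (⟨_^_,_^_,_^_⟩ Γ P κ b (p ∸ k) c (q + r) b k (basis t)))
                                    (upTo (suc (p ⊓ q)))

  divPow₃-exchange : ∀ {m b c} → b ≢ c → (t : Vec (Subset n) m) → All (IsIdeal P) t → ∀ p q r → p ≤ r →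
                     leftSide b c p q r t ≈Tuple rightSide b c p q r t
  divPow₃-exchange {b = b} {c} b≢c t t-ideal p q r p≤r u = begin
    coeffTuple u (⟨_^_,_^_,_^_⟩ Γ P κ c q b p c r (basis t))
      ≡⟨ coeffTuple-divPow₃ (≢-sym b≢c) t t-ideal r p q u ⟩
    ℕtoℚ (closedForm Tᵤ r p q)
      ≡⟨ cong ℕtoℚ (closedForm-exchange Tᵤ p q r p≤r) ⟨
    ℕtoℚ (sumBelow (suc (p ⊓ q)) term)
      ≡⟨ sumℚ-applyUpTo term (λ k → k) (suc (p ⊓ q)) ⟨
    sumℚ (map (ℕtoℚ ∘ term) (upTo (suc (p ⊓ q))))
      ≡⟨ cong sumℚ (map-cong coeffTuple-summand (upTo (suc (p ⊓ q)))) ⟨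
    sumℚ (map (coeffTuple u ∘ summand) (upTo (suc (p ⊓ q))))
      ≡⟨ coeffTuple-concatMap u summand (upTo (suc (p ⊓ q))) ⟨
    coeffTuple u (concatMap summand (upTo (suc (p ⊓ q)))) ∎
    where
    open ≡-Reasoning
    Tᵤ = tallyOf (routes c b t u)
    binom : ℕ → ℕ
    binom k = (q + r ∸ p) C (q ∸ k)
    term : ℕ → ℕ
    term k = binom k ℕ.* closedForm (swapTally Tᵤ) k (q + r) (p ∸ k)
    summand : ℕ → Combo n _
    summand k = scale (ℕtoℚ (binom k)) (⟨_^_,_^_,_^_⟩ Γ P κ b (p ∸ k) c (q + r) b k (basis t))
    coeffTuple-summand : ∀ k → coeffTuple u (summand k) ≡ ℕtoℚ (term k)
    coeffTuple-summand k = begin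
      coeffTuple u (summand k)
        ≡⟨ coeffTuple-scale u (ℕtoℚ (binom k)) (⟨_^_,_^_,_^_⟩ Γ P κ b (p ∸ k) c (q + r) b k (basis t)) ⟩
      ℕtoℚ (binom k) ℚ.* coeffTuple u (⟨_^_,_^_,_^_⟩ Γ P κ b (p ∸ k) c (q + r) b k (basis t))
        ≡⟨ cong (ℕtoℚ (binom k) ℚ.*_) (coeffTuple-divPow₃ b≢c t t-ideal k (q + r) (p ∸ k) u) ⟩
      ℕtoℚ (binom k) ℚ.* ℕtoℚ (closedForm (tallyOf (routes b c t u)) k (q + r) (p ∸ k))
        ≡⟨ cong (λ τs → ℕtoℚ (binom k) ℚ.* ℕtoℚ (closedForm (tallyOf τs) k (q + r) (p ∸ k)))
                (routes-swap (≢-sym b≢c) t u) ⟩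
      ℕtoℚ (binom k) ℚ.* ℕtoℚ (closedForm (tallyOf (map swapRoute (routes c b t u))) k (q + r) (p ∸ k))
        ≡⟨ cong (λ T′ → ℕtoℚ (binom k) ℚ.* ℕtoℚ (closedForm T′ k (q + r) (p ∸ k))) (tallyOf-swap (routes c b t u)) ⟩
      ℕtoℚ (binom k) ℚ.* ℕtoℚ (closedForm (swapTally Tᵤ) k (q + r) (p ∸ k))
        ≡⟨ ℕtoℚ-* (binom k) (closedForm (swapTally Tᵤ) k (q + r) (p ∸ k)) ⟨
      ℕtoℚ (term k) ∎

proposition5p6 : ∀ {n g : ℕ} (Γ : SimpleGraph g) (P : FinPoset (suc n)) (κ : Fin (suc n) → Fin g) →
    Surjective Γ P κ → Connected P → EC Γ P κ → NA Γ P κ → AC Γ P κ → ICE2 Γ P κ →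
    ∀ (m : ℕ) → 1 ≤ m → ∀ (p q r : ℕ) → p ≤ r → ∀ (b c : Fin g) → b ≢ c →
    ∀ (t : Vec (Subset (suc n)) m) → All (IsIdeal P) t →
      (⟨_^_,_^_,_^_⟩ Γ P κ c q b p c r (basis t)
        ≈Tuple concatMap (λ k → scale (ℕtoℚ ((q + r ∸ p) C (q ∸ k)))
                 (⟨_^_,_^_,_^_⟩ Γ P κ b (p ∸ k) c (q + r) b k (basis t))) (upTo (suc (p ⊓ q))))
      × (⟨_^_,_^_,_^_⟩ Γ P κ c q b p c r (basis t)
        ≈Multiset concatMap (λ k → scale (ℕtoℚ ((q + r ∸ p) C (q ∸ k)))
                 (⟨_^_,_^_,_^_⟩ Γ P κ b (p ∸ k) c (q + r) b k (basis t))) (upTo (suc (p ⊓ q))))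
proposition5p6 Γ P κ _ _ ec na _ ice _ _ p q r p≤r b c b≢c t t-ideal =
  tuples , ≈Tuple⇒≈Multiset {L = leftSide b c p q r t} {R = rightSide b c p q r t} tuples
  where
  open Coefficients Γ P κ ec na ice
  tuples = divPow₃-exchange b≢c t t-ideal p q r p≤r
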